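{- Let $n$ be a positive integer and let $2k$ be an even divisor of $2n$. The number of elements of $S_n$ fixed by $\mathcal{K}^{2k}$ is $\left(\frac nk\right)^k k!$, and the number of orbits of size $2k$ of the Kreweras complement $\mathcal{K}$ on $S_n$ equals $$\frac{\left(\frac nk\right)^k k!-T}{2k},$$ where $T$ is the total number of elements of $S_n$ lying in orbits of $\mathcal{K}$ whose size is a proper divisor of $2k$.
   Context: Permutations are in one-line notation and composed right to left. Let $c=234\cdots n1\in S_n$ (i.e. $c(i)=i+1$ for $i<n$, $c(n)=1$). The Kreweras complement is $\mathcal{K}:S_n\to S_n$, $\mathcal{K}(\sigma)=c\circ\sigma^{ -1}$. -}

module Defs where

open import Data.Nat using (ℕ; zero; suc; _∸_; _<?_; _≡ᵇ_; _<ᵇ_)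
open import Data.Bool using (Bool; true; false; _∧_; _∨_; not)
open import Data.Fin using (Fin; toℕ; fromℕ<) renaming (zero to fzero)
open import Data.Vec using (Vec; []; _∷_; lookup; tabulate; toList)
open import Data.List using (List; []; _∷_; [_]; map; concatMap; allFin; upTo; filterᵇ; length)
open import Data.Bool.ListAction using (all; any)
open import Relation.Nullary using (yes; no)

-- A permutation of [n] = {0,…,n-1} (0-indexed) in one-line notation:
-- σ is the vector (σ(0), …, σ(n-1)).
OneLine : ℕ → Set
OneLine n = Vec (Fin n) n

finEqᵇ : ∀ {n} → Fin n → Fin n → Bool
finEqᵇ i j = toℕ i ≡ᵇ toℕ j

vecEqᵇ : ∀ {n m} → Vec (Fin n) m → Vec (Fin n) m → Bool
vecEqᵇ [] [] = true
vecEqᵇ (x ∷ xs) (y ∷ ys) = finEqᵇ x y ∧ vecEqᵇ xs ys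

allVecs : ∀ {n} (m : ℕ) → List (Vec (Fin n) m)
allVecs zero = [ [] ]
allVecs {n} (suc m) = concatMap (λ i → map (i ∷_) (allVecs m)) (allFin n)

isPermᵇ : ∀ {n} → OneLine n → Bool
isPermᵇ {n} σ =
  all (λ i → all (λ j → not (finEqᵇ (lookup σ i) (lookup σ j)) ∨ finEqᵇ i j) (allFin n)) (allFin n)
  ∧ all (λ j → any (λ i → finEqᵇ (lookup σ i) j) (allFin n)) (allFin n)

Sn : (n : ℕ) → List (OneLine n)
Sn n = filterᵇ isPermᵇ (allVecs n)

countSn : (n : ℕ) → (OneLine n → Bool) → ℕ
countSn n p = length (filterᵇ p (Sn n))

-- the long cycle c: c(i) = i+1 for i < n-1, c(n-1) = 0  (0-indexed version of 23⋯n1)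
cyc : ∀ {n} → Fin n → Fin n
cyc {suc m} i with suc (toℕ i) <? suc m
... | yes p = fromℕ< p
... | no _ = fzero

-- first i with f i = j, defaulting to j (never used for permutations)
findPre : ∀ {n} → (Fin n → Fin n) → Fin n → List (Fin n) → Fin n
findPre f j [] = j
findPre f j (i ∷ is) with finEqᵇ (f i) j
... | true = i
... | false = findPre f j is

inv : ∀ {n} → OneLine n → OneLine n
inv {n} σ = tabulate (λ j → findPre (lookup σ) j (allFin n))

K : ∀ {n} → OneLine n → OneLine n
K σ = tabulate (λ i → cyc (lookup (inv σ) i))

Kpow : ∀ {n} → ℕ → OneLine n → OneLine n
Kpow zero σ = σ
Kpow (suc m) σ = K (Kpow m σ)

orbitSizeIsᵇ : ∀ {n} → ℕ → OneLine n → Bool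
orbitSizeIsᵇ zero σ = false
orbitSizeIsᵇ (suc d) σ =
  vecEqᵇ (Kpow (suc d) σ) σ ∧ all (λ e → not (vecEqᵇ (Kpow (suc e) σ) σ)) (upTo d)

lexLtᵇ : ∀ {n m} → Vec (Fin n) m → Vec (Fin n) m → Bool
lexLtᵇ [] [] = false
lexLtᵇ (x ∷ xs) (y ∷ ys) = (toℕ x <ᵇ toℕ y) ∨ (finEqᵇ x y ∧ lexLtᵇ xs ys)

-- σ is the lexicographically least element of its K-orbit, which has size d
-- (so each orbit of size d is counted exactly once by its canonical representative)
orbitRepᵇ : ∀ {n} → ℕ → OneLine n → Bool
orbitRepᵇ d σ = orbitSizeIsᵇ d σ ∧ all (λ j → not (lexLtᵇ (Kpow j σ) σ)) (upTo d)

numOrbitsOfSize : ℕ → ℕ → ℕ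
numOrbitsOfSize n d = countSn n (orbitRepᵇ d)

numFixedBy : ℕ → ℕ → ℕ
numFixedBy n m = countSn n (λ σ → vecEqᵇ (Kpow m σ) σ)

dividesᵇ : ℕ → ℕ → Bool
dividesᵇ d m = any (λ q → (q Data.Nat.* d) ≡ᵇ m) (upTo (suc m))

numInProperDivisorOrbits : ℕ → ℕ → ℕ
numInProperDivisorOrbits n m =
  countSn n (λ σ → any (λ d → dividesᵇ d m ∧ orbitSizeIsᵇ d σ) (upTo m))

-- K² is conjugation by the long cycle c, K (K σ) = c σ c⁻¹, so K^2k fixes σ exactly when σ commutes
-- with c^k.  When n = qk such a σ is determined by σ(0), …, σ(k−1), and these values may be chosen
-- freely subject to having pairwise distinct residues mod k; this gives qk · q(k−1) ⋯ q = q^k k!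
-- permutations.  The permutations fixed by K^2k are those whose K-orbit has size dividing 2k, and
-- those in orbits of size exactly 2k are counted orbit by orbit, each orbit being represented once
-- by its lexicographically least element.

module Submission where

open import Data.Bool using (Bool; true; false; T; not; _∧_; _∨_; if_then_else_)
open import Data.Bool.ListAction using (all; any)
open import Data.Bool.Properties using (T-∧; T-∨)
open import Data.Fin as Fin using (Fin; toℕ; fromℕ<; inject≤; punchOut)
import Data.Fin.Properties as Fin
open import Data.Fin.Properties
  using (any?; pigeonhole; punchOut-injective; toℕ-injective; toℕ<n; toℕ-fromℕ<; toℕ-inject≤)
open import Data.List
  using (List; []; _∷_; _++_; map; length; filterᵇ; concatMap; cartesianProductWith; allFin; tabulate; upTo)
open import Data.List.Membership.Propositional using (_∈_; _∉_; find; lose)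
open import Data.List.Membership.Propositional.Properties
  using (∈-allFin; ∈-upTo⁺; ∈-upTo⁻; ∈-map⁺; ∈-map⁻; ∈-filter⁺; ∈-filter⁻;
         ∈-cartesianProductWith⁺; ∈-cartesianProductWith⁻)
open import Data.List.Properties
  using (length-++; length-map; length-removeAt′; length-upTo; filter-++; filter-≐; map-tabulate)
open import Data.List.Relation.Binary.Subset.Propositional using (_⊆_)
open import Data.List.Relation.Unary.All using (All)
import Data.List.Relation.Unary.All as All
import Data.List.Relation.Unary.All.Properties as All
open import Data.List.Relation.Unary.All.Properties using (all⁺; all⁻; ¬Any⇒All¬)
open import Data.List.Relation.Unary.Any using (here; there; _─_)
open import Data.List.Relation.Unary.Any.Properties using (any⁺; any⁻)
open import Data.List.Relation.Unary.Unique.Propositional using (Unique; []; _∷_)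
open import Data.List.Relation.Unary.Unique.Propositional.Properties
  using (Unique[x∷xs]⇒x∉xs; ++⁺; map⁺; cartesianProductWith⁺; allFin⁺; upTo⁺; filter⁺)
open import Data.Nat
  using (ℕ; zero; suc; pred; _+_; _*_; _∸_; _^_; _!; _%_; _≤_; _<_; z≤n; s≤s; z<s; s<s; _<?_; _≡ᵇ_; NonZero; >-nonZero)
open import Data.Nat.DivMod
  using (_/_; m%n<n; m%n%n≡m%n; m<n⇒m%n≡m; n%n≡0; [m+n]%n≡m%n; [m+kn]%n≡m%n; %-distribˡ-+; m≡m%n+[m/n]*n;
         m<n*o⇒m/o<n; m<n⇒m/n≡0; m∣n⇒o%n%m≡o%m)
open import Data.Nat.Divisibility using (_∣_; divides)
open import Data.Nat.ListAction using (sum)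
open import Data.Nat.Properties
  using (≡ᵇ⇒≡; ≡⇒≡ᵇ; <ᵇ⇒<; <⇒<ᵇ; <-irrefl; <-trans; <-cmp; <-≤-trans; ≤-<-trans; ≤-antisym;
         <⇒≤; <⇒≢; ≮⇒≥;
         n<1+n; m<n⇒m<1+n; m<1+n⇒m<n∨m≡n; m≤n⇒m<n∨m≡n; suc-pred;
         +-suc; +-comm; +-identityʳ; *-comm; *-assoc; *-suc; *-identityˡ; *-zeroʳ; *-distribʳ-+; *-distribˡ-∸;
         *-cancelˡ-≡; *-monoˡ-<; m≤n*m; m≤m*n; m∸n+n≡m; m+n∸m≡n; m∸n≤m; m<n⇒0<n∸m)
open import Data.Nat.Tactic.RingSolver using (solve-∀)
open import Data.Product using (_×_; _,_; proj₁; proj₂; ∃; ∃₂)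
open import Data.Sum using (_⊎_; inj₁; inj₂)
import Data.Sum as Sum
open import Data.Vec using (Vec; []; _∷_; lookup)
import Data.Vec as Vec
open import Data.Vec.Properties using (≡-dec; ∷-injective; lookup∘tabulate; tabulate∘lookup; tabulate-cong)
open import Function using (_∘_; id; case_of_; Injective; Equivalence)
open import Relation.Binary.Definitions using (DecidableEquality; tri<; tri≈; tri>)
open import Relation.Binary.PropositionalEquality
  using (_≡_; _≢_; refl; sym; trans; cong; cong₂; subst; subst₂)
open import Relation.Nullary using (¬_; contradiction; yes; no)
open import Relation.Nullary.Decidable using (T?)
open import Relation.Unary using (Decidable)

open import Defs

open Relation.Binary.PropositionalEquality.≡-Reasoning

-- Finite counting

module _ {A : Set} where

  ∈-─⁺ : ∀ {xs : List A} {x y} (x∈xs : x ∈ xs) → y ∈ xs → y ≢ x → y ∈ (xs ─ x∈xs)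
  ∈-─⁺ (here refl)  (here refl)  y≢x = contradiction refl y≢x
  ∈-─⁺ (here refl)  (there y∈xs) _   = y∈xs
  ∈-─⁺ (there _)    (here refl)  _   = here refl
  ∈-─⁺ (there x∈xs) (there y∈xs) y≢x = there (∈-─⁺ x∈xs y∈xs y≢x)

  unique-⊆⇒length-≤ : ∀ {xs ys : List A} → Unique xs → xs ⊆ ys → length xs ≤ length ys
  unique-⊆⇒length-≤ [] _ = z≤n
  unique-⊆⇒length-≤ {x ∷ xs} {ys} u@(_ ∷ uxs) xs⊆ys =
    subst (suc (length xs) ≤_) (sym (length-removeAt′ ys _))
      (s≤s (unique-⊆⇒length-≤ uxs λ y∈xs →
        ∈-─⁺ x∈ys (xs⊆ys (there y∈xs)) λ { refl → Unique[x∷xs]⇒x∉xs u y∈xs }))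
    where x∈ys = xs⊆ys (here refl)

  unique-⊆-antisym⇒length-≡ : ∀ {xs ys : List A} → Unique xs → Unique ys →
    xs ⊆ ys → ys ⊆ xs → length xs ≡ length ys
  unique-⊆-antisym⇒length-≡ uxs uys xs⊆ys ys⊆xs =
    ≤-antisym (unique-⊆⇒length-≤ uxs xs⊆ys) (unique-⊆⇒length-≤ uys ys⊆xs)

  length-filterᵇ-++ : ∀ (p : A → Bool) xs ys →
    length (filterᵇ p (xs ++ ys)) ≡ length (filterᵇ p xs) + length (filterᵇ p ys)
  length-filterᵇ-++ p xs ys = trans (cong length (filter-++ (T? ∘ p) xs ys)) (length-++ (filterᵇ p xs))

  length-filterᵇ-disjoint-∨ : ∀ (a b : A → Bool) (xs : List A) → (∀ {x} → x ∈ xs → T (a x) → ¬ T (b x)) →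
    length (filterᵇ (λ x → a x ∨ b x) xs) ≡ length (filterᵇ a xs) + length (filterᵇ b xs)
  length-filterᵇ-disjoint-∨ a b [] _ = refl
  length-filterᵇ-disjoint-∨ a b (x ∷ xs) a⇒¬b with a x in ax | b x in bx
  ... | true  | true  = contradiction (subst T (sym bx) _) (a⇒¬b (here refl) (subst T (sym ax) _))
  ... | true  | false = cong suc (length-filterᵇ-disjoint-∨ a b xs (a⇒¬b ∘ there))
  ... | false | true  = trans (cong suc (length-filterᵇ-disjoint-∨ a b xs (a⇒¬b ∘ there))) (sym (+-suc _ _))
  ... | false | false = length-filterᵇ-disjoint-∨ a b xs (a⇒¬b ∘ there)

  length-filterᵇ-false : ∀ (xs : List A) → length (filterᵇ (λ _ → false) xs) ≡ 0
  length-filterᵇ-false []       = refl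
  length-filterᵇ-false (x ∷ xs) = length-filterᵇ-false xs

  sum-map-indicator : ∀ (p : A → Bool) (c : ℕ) (g : A → ℕ) xs → (∀ x → g x ≡ (if p x then c else 0)) →
    sum (map g xs) ≡ length (filterᵇ p xs) * c
  sum-map-indicator p c g [] _ = refl
  sum-map-indicator p c g (x ∷ xs) g≡ with p x | g≡ x
  ... | true  | gx≡c = cong₂ _+_ gx≡c (sum-map-indicator p c g xs g≡)
  ... | false | gx≡0 = trans (cong (_+ sum (map g xs)) gx≡0) (sum-map-indicator p c g xs g≡)

module _ {A B : Set} where

  length-filterᵇ-map : ∀ (p : B → Bool) (g : A → B) xs →
    length (filterᵇ p (map g xs)) ≡ length (filterᵇ (p ∘ g) xs)
  length-filterᵇ-map p g [] = refl
  length-filterᵇ-map p g (x ∷ xs) with p (g x)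
  ... | true  = cong suc (length-filterᵇ-map p g xs)
  ... | false = length-filterᵇ-map p g xs

  map-unique : ∀ (f : A → B) {xs} → Unique xs → (∀ {x y} → x ∈ xs → y ∈ xs → f x ≡ f y → x ≡ y) →
    Unique (map f xs)
  map-unique f [] _ = []
  map-unique f (x≢xs ∷ uxs) f-inj =
    All.map⁺ (All.tabulate λ y∈xs fx≡fy → All.lookup x≢xs y∈xs (f-inj (here refl) (there y∈xs) fx≡fy))
    ∷ map-unique f uxs λ p q → f-inj (there p) (there q)

module _ {A B C : Set} (f : A → B → C) where

  concatMap-map≡cartesianProductWith : ∀ xs ys →
    concatMap (λ x → map (f x) ys) xs ≡ cartesianProductWith f xs ys
  concatMap-map≡cartesianProductWith []       ys = refl
  concatMap-map≡cartesianProductWith (x ∷ xs) ys =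
    cong (map (f x) ys ++_) (concatMap-map≡cartesianProductWith xs ys)

  length-cartesianProductWith : ∀ xs ys →
    length (cartesianProductWith f xs ys) ≡ length xs * length ys
  length-cartesianProductWith []       ys = refl
  length-cartesianProductWith (x ∷ xs) ys = trans (length-++ (map (f x) ys))
    (cong₂ _+_ (length-map (f x) ys) (length-cartesianProductWith xs ys))

  cartesianProductWith-unique : ∀ {xs ys} → Unique xs → Unique ys →
    (∀ {x x′ y y′} → x ∈ xs → x′ ∈ xs → y ∈ ys → y′ ∈ ys →
      f x y ≡ f x′ y′ → x ≡ x′ × y ≡ y′) →
    Unique (cartesianProductWith f xs ys)
  cartesianProductWith-unique [] _ _ = []
  cartesianProductWith-unique {x ∷ xs} {ys} uxs@(_ ∷ uxs′) uys f-inj =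
    ++⁺ (map-unique (f x) uys λ p q e → proj₂ (f-inj (here refl) (here refl) p q e))
        (cartesianProductWith-unique uxs′ uys λ p p′ → f-inj (there p) (there p′))
        λ (v∈row , v∈rest) →
          let y , y∈ys , v≡fxy = ∈-map⁻ (f x) v∈row
              x′ , y′ , x′∈xs , y′∈ys , v≡fx′y′ = ∈-cartesianProductWith⁻ f xs ys v∈rest
          in Unique[x∷xs]⇒x∉xs uxs (subst (_∈ xs)
               (sym (proj₁ (f-inj (here refl) (there x′∈xs) y∈ys y′∈ys (trans (sym v≡fxy) v≡fx′y′)))) x′∈xs)

  length-filterᵇ-cartesianProductWith : ∀ (p : C → Bool) xs ys →
    length (filterᵇ p (cartesianProductWith f xs ys)) ≡ sum (map (λ x → length (filterᵇ (p ∘ f x) ys)) xs)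
  length-filterᵇ-cartesianProductWith p []       ys = refl
  length-filterᵇ-cartesianProductWith p (x ∷ xs) ys = trans (length-filterᵇ-++ p (map (f x) ys) _)
    (cong₂ _+_ (length-filterᵇ-map p (f x) ys) (length-filterᵇ-cartesianProductWith p xs ys))

T-not⇒¬T : ∀ {b} → T (not b) → ¬ T b
T-not⇒¬T {false} _ ()

¬T⇒T-not : ∀ {b} → ¬ T b → T (not b)
¬T⇒T-not {true}  ¬tt = ¬tt _
¬T⇒T-not {false} _   = _

module _ {A : Set} (p : A → Bool) (xs : List A) where

  T-all-lookup : T (all p xs) → ∀ {x} → x ∈ xs → T (p x)
  T-all-lookup ok = All.lookup (all⁺ p xs ok)

  T-all-tabulate : (∀ {x} → x ∈ xs → T (p x)) → T (all p xs)
  T-all-tabulate ok = all⁻ p (All.tabulate ok)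

  T-any-find : T (any p xs) → ∃ λ x → x ∈ xs × T (p x)
  T-any-find ok = find (any⁻ p xs ok)

  T-any-lose : ∀ {x} → x ∈ xs → T (p x) → T (any p xs)
  T-any-lose x∈xs px = any⁺ p (lose x∈xs px)

countBelow : (ℕ → Bool) → ℕ → ℕ
countBelow p zero    = 0
countBelow p (suc n) = if p 0 then suc (countBelow (p ∘ suc) n) else countBelow (p ∘ suc) n

length-filterᵇ-tabulate-suc : ∀ (p : ℕ → Bool) n →
  length (filterᵇ (p ∘ toℕ) (tabulate (Fin.suc {n}))) ≡ countBelow (p ∘ suc) n
length-filterᵇ-allFin : ∀ (p : ℕ → Bool) n → length (filterᵇ (p ∘ toℕ) (allFin n)) ≡ countBelow p n
length-filterᵇ-allFin p zero    = refl
length-filterᵇ-allFin p (suc n) with p 0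
... | true  = cong suc (length-filterᵇ-tabulate-suc p n)
... | false = length-filterᵇ-tabulate-suc p n

length-filterᵇ-tabulate-suc p n = begin
  length (filterᵇ (p ∘ toℕ) (tabulate (Fin.suc {n})))
    ≡⟨ cong (length ∘ filterᵇ (p ∘ toℕ)) (sym (map-tabulate id (Fin.suc {n}))) ⟩
  length (filterᵇ (p ∘ toℕ) (map (Fin.suc {n}) (allFin n)))
    ≡⟨ length-filterᵇ-map (p ∘ toℕ) Fin.suc (allFin n) ⟩
  length (filterᵇ (p ∘ suc ∘ toℕ) (allFin n))
    ≡⟨ length-filterᵇ-allFin (p ∘ suc) n ⟩
  countBelow (p ∘ suc) n
    ∎

countBelow-+ : ∀ (p : ℕ → Bool) a b → countBelow p (a + b) ≡ countBelow p a + countBelow (λ x → p (a + x)) b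
countBelow-+ p zero    b = refl
countBelow-+ p (suc a) b with p 0
... | true  = cong suc (countBelow-+ (p ∘ suc) a b)
... | false = countBelow-+ (p ∘ suc) a b

countBelow-cong : ∀ {p p′ : ℕ → Bool} n → (∀ {x} → x < n → p x ≡ p′ x) → countBelow p n ≡ countBelow p′ n
countBelow-cong zero    _ = refl
countBelow-cong {p} {p′} (suc n) p≡p′ rewrite p≡p′ z<s =
  cong (λ c → if p′ 0 then suc c else c) (countBelow-cong n λ x<n → p≡p′ (s<s x<n))

countBelow-periodic : ∀ (p : ℕ → Bool) k q → (∀ x → p (k + x) ≡ p x) → countBelow p (q * k) ≡ q * countBelow p k
countBelow-periodic p k zero    _        = refl
countBelow-periodic p k (suc q) periodic = begin
  countBelow p (k + q * k)                               ≡⟨ countBelow-+ p k (q * k) ⟩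
  countBelow p k + countBelow (λ x → p (k + x)) (q * k)  ≡⟨ cong (countBelow p k +_) (countBelow-cong (q * k) λ _ → periodic _) ⟩
  countBelow p k + countBelow p (q * k)                  ≡⟨ cong (countBelow p k +_) (countBelow-periodic p k q periodic) ⟩
  countBelow p k + q * countBelow p k                    ∎

countBelow-complement : ∀ (p : ℕ → Bool) n → countBelow p n + countBelow (not ∘ p) n ≡ n
countBelow-complement p zero = refl
countBelow-complement p (suc n) with p 0
... | true  = cong suc (countBelow-complement (p ∘ suc) n)
... | false = trans (+-suc _ _) (cong suc (countBelow-complement (p ∘ suc) n))

countBelow-disjoint-∨ : ∀ (p p′ : ℕ → Bool) n → (∀ x → T (p x) → ¬ T (p′ x)) →
  countBelow (λ x → p x ∨ p′ x) n ≡ countBelow p n + countBelow p′ n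
countBelow-disjoint-∨ p p′ zero _ = refl
countBelow-disjoint-∨ p p′ (suc n) p⇒¬p′ with p 0 in p0 | p′ 0 in p′0
... | true  | true  = contradiction (subst T (sym p′0) _) (p⇒¬p′ 0 (subst T (sym p0) _))
... | true  | false = cong suc (countBelow-disjoint-∨ (p ∘ suc) (p′ ∘ suc) n (p⇒¬p′ ∘ suc))
... | false | true  = trans (cong suc (countBelow-disjoint-∨ (p ∘ suc) (p′ ∘ suc) n (p⇒¬p′ ∘ suc))) (sym (+-suc _ _))
... | false | false = countBelow-disjoint-∨ (p ∘ suc) (p′ ∘ suc) n (p⇒¬p′ ∘ suc)

countBelow-false : ∀ n → countBelow (λ _ → false) n ≡ 0
countBelow-false zero    = refl
countBelow-false (suc n) = countBelow-false n

countBelow-≡ᵇ : ∀ {s n} → s < n → countBelow (_≡ᵇ s) n ≡ 1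
countBelow-≡ᵇ {zero}  {suc n} _         = cong suc (countBelow-false n)
countBelow-≡ᵇ {suc s} {suc n} (s<s s<n) = countBelow-≡ᵇ s<n

infix 4 _∈ᵇ_
_∈ᵇ_ : ℕ → List ℕ → Bool
x ∈ᵇ S = any (x ≡ᵇ_) S

∈ᵇ⇒∈ : ∀ {x S} → T (x ∈ᵇ S) → x ∈ S
∈ᵇ⇒∈ {x} {S} x∈S = let y , y∈S , x≡y = T-any-find (x ≡ᵇ_) S x∈S in subst (_∈ S) (sym (≡ᵇ⇒≡ x y x≡y)) y∈S

∈⇒∈ᵇ : ∀ {x S} → x ∈ S → T (x ∈ᵇ S)
∈⇒∈ᵇ {x} {S} x∈S = T-any-lose (x ≡ᵇ_) S x∈S (≡⇒≡ᵇ x x refl)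

not-∈ᵇ⇒∉ : ∀ {x S} → T (not (x ∈ᵇ S)) → x ∉ S
not-∈ᵇ⇒∉ x∉S = T-not⇒¬T x∉S ∘ ∈⇒∈ᵇ

∉⇒not-∈ᵇ : ∀ {x S} → x ∉ S → T (not (x ∈ᵇ S))
∉⇒not-∈ᵇ x∉S = ¬T⇒T-not (x∉S ∘ ∈ᵇ⇒∈)

countBelow-member : ∀ {n} (S : List ℕ) → Unique S → All (_< n) S → countBelow (_∈ᵇ S) n ≡ length S
countBelow-member {n} [] _ _ = countBelow-false n
countBelow-member {n} (s ∷ S) (s∉S ∷ uS) (s<n All.∷ S<n) = begin
  countBelow (λ x → (x ≡ᵇ s) ∨ (x ∈ᵇ S)) n               ≡⟨ countBelow-disjoint-∨ (_≡ᵇ s) (_∈ᵇ S) n disjoint ⟩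
  countBelow (_≡ᵇ s) n + countBelow (_∈ᵇ S) n  ≡⟨ cong₂ _+_ (countBelow-≡ᵇ s<n) (countBelow-member S uS S<n) ⟩
  suc (length S)                                             ∎
  where
  disjoint : ∀ x → T (x ≡ᵇ s) → ¬ T (x ∈ᵇ S)
  disjoint x x≡s x∈S with ≡ᵇ⇒≡ x s x≡s
  ... | refl = All.lookup s∉S (∈ᵇ⇒∈ x∈S) refl

-- One-line notation

injective⇒surjective : ∀ {n} {f : Fin n → Fin n} → Injective _≡_ _≡_ f → ∀ y → ∃ λ x → f x ≡ y
injective⇒surjective {suc m} {f} f-inj y with any? (λ x → f x Fin.≟ y)
... | yes hit = hit
... | no miss = contradiction (pigeonhole (n<1+n m) squeeze) no-collision
  where
  y≢f : ∀ x → y ≢ f x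
  y≢f x y≡fx = miss (x , sym y≡fx)
  squeeze : Fin (suc m) → Fin m
  squeeze x = punchOut (y≢f x)
  no-collision : ¬ ∃₂ λ x x′ → x Fin.< x′ × squeeze x ≡ squeeze x′
  no-collision (x , x′ , x<x′ , eq) with f-inj (punchOut-injective (y≢f x) (y≢f x′) eq)
  ... | refl = <-irrefl refl x<x′

finEqᵇ-refl : ∀ {n} (i : Fin n) → T (finEqᵇ i i)
finEqᵇ-refl i = ≡⇒≡ᵇ (toℕ i) (toℕ i) refl

finEqᵇ⇒≡ : ∀ {n} {i j : Fin n} → T (finEqᵇ i j) → i ≡ j
finEqᵇ⇒≡ {i = i} {j} eq = toℕ-injective (≡ᵇ⇒≡ (toℕ i) (toℕ j) eq)

vecEqᵇ-refl : ∀ {n m} (v : Vec (Fin n) m) → T (vecEqᵇ v v)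
vecEqᵇ-refl []       = _
vecEqᵇ-refl (x ∷ v) = Equivalence.from T-∧ (finEqᵇ-refl x , vecEqᵇ-refl v)

vecEqᵇ⇒≡ : ∀ {n m} {v w : Vec (Fin n) m} → T (vecEqᵇ v w) → v ≡ w
vecEqᵇ⇒≡ {v = []}    {[]}    _  = refl
vecEqᵇ⇒≡ {v = x ∷ v} {y ∷ w} eq =
  let x≡y , v≡w = Equivalence.to T-∧ eq in cong₂ _∷_ (finEqᵇ⇒≡ x≡y) (vecEqᵇ⇒≡ v≡w)

≡⇒vecEqᵇ : ∀ {n m} {v w : Vec (Fin n) m} → v ≡ w → T (vecEqᵇ v w)
≡⇒vecEqᵇ {v = v} refl = vecEqᵇ-refl v

not-vecEqᵇ⇒≢ : ∀ {n m} {v w : Vec (Fin n) m} → T (not (vecEqᵇ v w)) → v ≢ w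
not-vecEqᵇ⇒≢ v≉w = T-not⇒¬T v≉w ∘ ≡⇒vecEqᵇ

≢⇒not-vecEqᵇ : ∀ {n m} {v w : Vec (Fin n) m} → v ≢ w → T (not (vecEqᵇ v w))
≢⇒not-vecEqᵇ v≢w = ¬T⇒T-not (v≢w ∘ vecEqᵇ⇒≡)

_≟_ : ∀ {n m} → DecidableEquality (Vec (Fin n) m)
_≟_ = ≡-dec Fin._≟_

lookup-extensionality : ∀ {A : Set} {n} {v w : Vec A n} → (∀ i → lookup v i ≡ lookup w i) → v ≡ w
lookup-extensionality {v = v} {w} v≗w = trans (sym (tabulate∘lookup v)) (trans (tabulate-cong v≗w) (tabulate∘lookup w))

module _ {n : ℕ} where

  lexLtᵇ-head : ∀ {m} {x y : Fin n} (v w : Vec (Fin n) m) → toℕ x < toℕ y → T (lexLtᵇ (x ∷ v) (y ∷ w))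
  lexLtᵇ-head _ _ x<y = Equivalence.from T-∨ (inj₁ (<⇒<ᵇ x<y))

  lexLtᵇ-tail : ∀ {m} (x : Fin n) (v w : Vec (Fin n) m) → T (lexLtᵇ v w) → T (lexLtᵇ (x ∷ v) (x ∷ w))
  lexLtᵇ-tail x _ _ v<w = Equivalence.from T-∨ (inj₂ (Equivalence.from T-∧ (finEqᵇ-refl x , v<w)))

  lexLtᵇ-cases : ∀ {m} {x y : Fin n} (v w : Vec (Fin n) m) → T (lexLtᵇ (x ∷ v) (y ∷ w)) →
    toℕ x < toℕ y ⊎ (x ≡ y × T (lexLtᵇ v w))
  lexLtᵇ-cases {x = x} {y} v w lt with Equivalence.to T-∨ lt
  ... | inj₁ x<y  = inj₁ (<ᵇ⇒< (toℕ x) (toℕ y) x<y)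
  ... | inj₂ tail = let x≡y , v<w = Equivalence.to (T-∧ {finEqᵇ x y}) tail in inj₂ (finEqᵇ⇒≡ x≡y , v<w)

  lexLtᵇ-irrefl : ∀ {m} (v : Vec (Fin n) m) → ¬ T (lexLtᵇ v v)
  lexLtᵇ-irrefl (x ∷ v) lt with lexLtᵇ-cases {x = x} {x} v v lt
  ... | inj₁ x<x       = <-irrefl refl x<x
  ... | inj₂ (_ , v<v) = lexLtᵇ-irrefl v v<v

  lexLtᵇ-trans : ∀ {m} (u v w : Vec (Fin n) m) → T (lexLtᵇ u v) → T (lexLtᵇ v w) → T (lexLtᵇ u w)
  lexLtᵇ-trans []      []      []      ()
  lexLtᵇ-trans (x ∷ u) (y ∷ v) (z ∷ w) u<v v<w with lexLtᵇ-cases {x = x} {y} u v u<v | lexLtᵇ-cases {x = y} {z} v w v<w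
  ... | inj₁ x<y          | inj₁ y<z          = lexLtᵇ-head u w (<-trans x<y y<z)
  ... | inj₁ x<y          | inj₂ (refl , _)   = lexLtᵇ-head u w x<y
  ... | inj₂ (refl , _)   | inj₁ y<z          = lexLtᵇ-head u w y<z
  ... | inj₂ (refl , u<v′) | inj₂ (refl , v<w′) = lexLtᵇ-tail x u w (lexLtᵇ-trans u v w u<v′ v<w′)

  lexLtᵇ-total : ∀ {m} (v w : Vec (Fin n) m) → v ≢ w → T (lexLtᵇ v w) ⊎ T (lexLtᵇ w v)
  lexLtᵇ-total []      []      v≢w = contradiction refl v≢w
  lexLtᵇ-total (x ∷ v) (y ∷ w) v≢w with <-cmp (toℕ x) (toℕ y)
  ... | tri< x<y _ _ = inj₁ (lexLtᵇ-head v w x<y)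
  ... | tri> _ _ y<x = inj₂ (lexLtᵇ-head w v y<x)
  ... | tri≈ _ x≡y _ with toℕ-injective x≡y
  ...   | refl = Sum.map (lexLtᵇ-tail x v w) (lexLtᵇ-tail x w v) (lexLtᵇ-total v w (v≢w ∘ cong (x ∷_)))

  lexLtᵇ-minimum : ∀ {m} (xs : List (Vec (Fin n) m)) {z} → z ∈ xs →
    ∃ λ y → y ∈ xs × (∀ {x} → x ∈ xs → ¬ T (lexLtᵇ x y))
  lexLtᵇ-minimum (x ∷ [])      _ = x , here refl , λ { (here refl) → lexLtᵇ-irrefl x }
  lexLtᵇ-minimum (x ∷ x′ ∷ xs) _ with lexLtᵇ-minimum (x′ ∷ xs) (here refl)
  ... | y , y∈xs , y-min with lexLtᵇ x y in x<y
  ...   | false = y , there y∈xs , λ { (here refl) → subst T x<y ; (there z∈xs) → y-min z∈xs }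
  ...   | true  = x , here refl , λ { (here refl) → lexLtᵇ-irrefl x
                                    ; {z} (there z∈xs) z<x → y-min z∈xs (lexLtᵇ-trans z x y z<x (subst T (sym x<y) _)) }

-- A record rather than a synonym for injectivity, so that σ can be inferred from a proof.
record IsPerm {n} (σ : OneLine n) : Set where
  constructor isPerm
  field injective : Injective _≡_ _≡_ (lookup σ)

module _ {n} (σ : OneLine n) where

  private
    injectiveAt : Fin n → Fin n → Bool
    injectiveAt i j = not (finEqᵇ (lookup σ i) (lookup σ j)) ∨ finEqᵇ i j

    hits : Fin n → Fin n → Bool
    hits j i = finEqᵇ (lookup σ i) j

    σ-finEqᵇ : ∀ {i j} → lookup σ i ≡ j → T (hits j i)
    σ-finEqᵇ {i} refl = finEqᵇ-refl (lookup σ i)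

  isPermᵇ⇒IsPerm : T (isPermᵇ σ) → IsPerm σ
  isPermᵇ⇒IsPerm ok = isPerm λ σi≡σj → finEqᵇ⇒≡ (modus-ponens (clause _ _) (σ-finEqᵇ σi≡σj))
    where
    modus-ponens : ∀ {a b} → T (not a ∨ b) → T a → T b
    modus-ponens {true} b _ = b
    clause : ∀ i j → T (injectiveAt i j)
    clause i j = T-all-lookup (injectiveAt i) (allFin n)
      (T-all-lookup (λ i → all (injectiveAt i) (allFin n)) (allFin n) (proj₁ (Equivalence.to T-∧ ok)) (∈-allFin i))
      (∈-allFin j)

  IsPerm⇒isPermᵇ : IsPerm σ → T (isPermᵇ σ)
  IsPerm⇒isPermᵇ (isPerm σ-inj) = Equivalence.from T-∧
    ( T-all-tabulate (λ i → all (injectiveAt i) (allFin n)) (allFin n) (λ {i} _ →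
        T-all-tabulate (injectiveAt i) (allFin n) λ {j} _ → injective-clause i j)
    , T-all-tabulate (λ j → any (hits j) (allFin n)) (allFin n) λ {j} _ →
        let i , σi≡j = injective⇒surjective σ-inj j in
        T-any-lose (hits j) (allFin n) (∈-allFin i) (σ-finEqᵇ σi≡j))
    where
    injective-clause : ∀ i j → T (injectiveAt i j)
    injective-clause i j with finEqᵇ (lookup σ i) (lookup σ j) in eq
    ... | true  = subst (λ y → T (finEqᵇ i y)) (σ-inj (finEqᵇ⇒≡ (subst T (sym eq) _))) (finEqᵇ-refl i)
    ... | false = _

∈-allVecs : ∀ {n} m (v : Vec (Fin n) m) → v ∈ allVecs m
∈-allVecs zero    []      = here refl
∈-allVecs {n} (suc m) (x ∷ v) = subst (x ∷ v ∈_) (sym (concatMap-map≡cartesianProductWith _∷_ (allFin n) (allVecs m)))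
  (∈-cartesianProductWith⁺ _∷_ (∈-allFin x) (∈-allVecs m v))

allVecs-unique : ∀ {n} m → Unique (allVecs {n} m)
allVecs-unique zero = All.[] ∷ []
allVecs-unique {n} (suc m) = subst Unique (sym (concatMap-map≡cartesianProductWith _∷_ (allFin n) (allVecs m)))
  (cartesianProductWith⁺ _∷_ ∷-injective (allFin⁺ n) (allVecs-unique m))

∈-Sn⁻ : ∀ {n} {σ : OneLine n} → σ ∈ Sn n → IsPerm σ
∈-Sn⁻ {n} {σ} σ∈Sn = isPermᵇ⇒IsPerm σ (proj₂ (∈-filter⁻ (T? ∘ isPermᵇ) {xs = allVecs n} σ∈Sn))

∈-Sn⁺ : ∀ {n} {σ : OneLine n} → IsPerm σ → σ ∈ Sn n
∈-Sn⁺ {n} {σ} σ-perm = ∈-filter⁺ (T? ∘ isPermᵇ) (∈-allVecs n σ) (IsPerm⇒isPermᵇ σ σ-perm)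

Sn-unique : ∀ n → Unique (Sn n)
Sn-unique n = filter⁺ (T? ∘ isPermᵇ) (allVecs-unique n)

-- Powers of the long cycle

cyc^ : ∀ {n} → ℕ → Fin n → Fin n
cyc^ zero    i = i
cyc^ (suc t) i = cyc (cyc^ t i)

cyc^-+ : ∀ {n} a b (i : Fin n) → cyc^ a (cyc^ b i) ≡ cyc^ (a + b) i
cyc^-+ zero    b i = refl
cyc^-+ (suc a) b i = cong cyc (cyc^-+ a b i)

cyc^-comm : ∀ {n} a b (i : Fin n) → cyc^ a (cyc^ b i) ≡ cyc^ b (cyc^ a i)
cyc^-comm a b i = trans (cyc^-+ a b i) (trans (cong (λ t → cyc^ t i) (+-comm a b)) (sym (cyc^-+ b a i)))

module _ {m : ℕ} where

  private
    N = suc m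

  toℕ-cyc : ∀ (i : Fin N) → toℕ (cyc i) ≡ suc (toℕ i) % N
  toℕ-cyc i with suc (toℕ i) <? N
  ... | yes i+1<N = trans (toℕ-fromℕ< i+1<N) (sym (m<n⇒m%n≡m i+1<N))
  ... | no  i+1≮N = trans (sym (n%n≡0 N)) (cong (_% N) (sym i+1≡N))
    where
    i+1≡N : suc (toℕ i) ≡ N
    i+1≡N = ≤-antisym (toℕ<n i) (≮⇒≥ i+1≮N)

  toℕ-cyc^ : ∀ t (i : Fin N) → toℕ (cyc^ t i) ≡ (toℕ i + t) % N
  toℕ-cyc^ zero    i = trans (sym (m<n⇒m%n≡m (toℕ<n i))) (cong (_% N) (sym (+-identityʳ (toℕ i))))
  toℕ-cyc^ (suc t) i = begin
    toℕ (cyc (cyc^ t i))             ≡⟨ toℕ-cyc (cyc^ t i) ⟩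
    suc (toℕ (cyc^ t i)) % N         ≡⟨ cong (λ x → suc x % N) (toℕ-cyc^ t i) ⟩
    suc ((toℕ i + t) % N) % N        ≡⟨ %-distribˡ-+ 1 ((toℕ i + t) % N) N ⟩
    (1 % N + (toℕ i + t) % N % N) % N ≡⟨ cong (λ x → (1 % N + x) % N) (m%n%n≡m%n (toℕ i + t) N) ⟩
    (1 % N + (toℕ i + t) % N) % N    ≡⟨ sym (%-distribˡ-+ 1 (toℕ i + t) N) ⟩
    suc (toℕ i + t) % N              ≡⟨ cong (_% N) (sym (+-suc (toℕ i) t)) ⟩
    (toℕ i + suc t) % N              ∎

  cyc^-multiple : ∀ s (i : Fin N) → cyc^ (s * N) i ≡ i
  cyc^-multiple s i = toℕ-injective (begin
    toℕ (cyc^ (s * N) i)   ≡⟨ toℕ-cyc^ (s * N) i ⟩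
    (toℕ i + s * N) % N    ≡⟨ [m+kn]%n≡m%n (toℕ i) s N ⟩
    toℕ i % N              ≡⟨ m<n⇒m%n≡m (toℕ<n i) ⟩
    toℕ i                  ∎)

  cyc^-inverseˡ : ∀ t (i : Fin N) → cyc^ (m * t) (cyc^ t i) ≡ i
  cyc^-inverseˡ t i = trans (cyc^-+ (m * t) t i) (trans (cong (λ s → cyc^ s i) m*t+t≡t*N) (cyc^-multiple t i))
    where
    m*t+t≡t*N : m * t + t ≡ t * N
    m*t+t≡t*N = trans (+-comm (m * t) t) (*-comm N t)

  cyc^-inverseʳ : ∀ t (i : Fin N) → cyc^ t (cyc^ (m * t) i) ≡ i
  cyc^-inverseʳ t i = trans (cyc^-comm t (m * t) i) (cyc^-inverseˡ t i)

  cyc^-injective : ∀ t → Injective _≡_ _≡_ (cyc^ {N} t)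
  cyc^-injective t {i} {j} eq = trans (sym (cyc^-inverseˡ t i)) (trans (cong (cyc^ (m * t)) eq) (cyc^-inverseˡ t j))

  cyc^-fromZero : ∀ (i : Fin N) → cyc^ (toℕ i) Fin.zero ≡ i
  cyc^-fromZero i = toℕ-injective (trans (toℕ-cyc^ (toℕ i) Fin.zero) (m<n⇒m%n≡m (toℕ<n i)))

  cyc^-determined-by-point : ∀ a b {i : Fin N} → cyc^ a i ≡ cyc^ b i → ∀ j → cyc^ a j ≡ cyc^ b j
  cyc^-determined-by-point a b {i} eq j = begin
    cyc^ a j                         ≡⟨ cong (cyc^ a) (sym (cyc^-fromZero j)) ⟩
    cyc^ a (cyc^ (toℕ j) Fin.zero)   ≡⟨ cyc^-comm a (toℕ j) Fin.zero ⟩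
    cyc^ (toℕ j) (cyc^ a Fin.zero)   ≡⟨ cong (cyc^ (toℕ j)) at-zero ⟩
    cyc^ (toℕ j) (cyc^ b Fin.zero)   ≡⟨ cyc^-comm (toℕ j) b Fin.zero ⟩
    cyc^ b (cyc^ (toℕ j) Fin.zero)   ≡⟨ cong (cyc^ b) (cyc^-fromZero j) ⟩
    cyc^ b j                         ∎
    where
    shifted : ∀ c → cyc^ (toℕ i) (cyc^ c Fin.zero) ≡ cyc^ c i
    shifted c = trans (cyc^-comm (toℕ i) c Fin.zero) (cong (cyc^ c) (cyc^-fromZero i))
    at-zero : cyc^ a Fin.zero ≡ cyc^ b Fin.zero
    at-zero = cyc^-injective (toℕ i) (trans (shifted a) (trans eq (sym (shifted b))))

  cyc^-fixed-point-free : ∀ {d} → 0 < d → d < N → ∀ (i : Fin N) → cyc^ d i ≢ i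
  cyc^-fixed-point-free {d} 0<d d<N i fixed = <⇒≢ 0<d (sym d≡0)
    where
    d≡0 : d ≡ 0
    d≡0 = begin
      d                         ≡⟨ sym (m<n⇒m%n≡m d<N) ⟩
      d % N                     ≡⟨ sym (toℕ-cyc^ d Fin.zero) ⟩
      toℕ (cyc^ d Fin.zero)     ≡⟨ cong toℕ (cyc^-determined-by-point d 0 fixed Fin.zero) ⟩
      0                         ∎

cyc-injective : ∀ {n} → Injective _≡_ _≡_ (cyc {n})
cyc-injective {suc m} = cyc^-injective 1

-- The Kreweras complement

lookup-findPre : ∀ {n} (f : Fin n → Fin n) j xs {i} → i ∈ xs → f i ≡ j → f (findPre f j xs) ≡ j
lookup-findPre f j (x ∷ xs) i∈xs fi≡j with finEqᵇ (f x) j in hit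
... | true = finEqᵇ⇒≡ (subst T (sym hit) _)
lookup-findPre f j (x ∷ xs) (here refl) refl | false = contradiction (finEqᵇ-refl (f x)) (subst T hit)
lookup-findPre f j (x ∷ xs) (there i∈xs) fi≡j | false = lookup-findPre f j xs i∈xs fi≡j

module _ {n} {σ : OneLine n} (σ-perm : IsPerm σ) where

  lookup-inverseʳ : ∀ j → lookup σ (lookup (inv σ) j) ≡ j
  lookup-inverseʳ j = begin
    lookup σ (lookup (inv σ) j)                     ≡⟨ cong (lookup σ) (lookup∘tabulate _ j) ⟩
    lookup σ (findPre (lookup σ) j (allFin n))      ≡⟨ lookup-findPre (lookup σ) j (allFin n) (∈-allFin i) σi≡j ⟩
    j                                               ∎
    where
    i = proj₁ (injective⇒surjective (IsPerm.injective σ-perm) j)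
    σi≡j = proj₂ (injective⇒surjective (IsPerm.injective σ-perm) j)

  lookup-inverseˡ : ∀ i → lookup (inv σ) (lookup σ i) ≡ i
  lookup-inverseˡ i = IsPerm.injective σ-perm (lookup-inverseʳ (lookup σ i))

lookup-K : ∀ {n} (σ : OneLine n) i → lookup (K σ) i ≡ cyc (lookup (inv σ) i)
lookup-K σ i = lookup∘tabulate (λ i → cyc (lookup (inv σ) i)) i

K-isPerm : ∀ {n} {σ : OneLine n} → IsPerm σ → IsPerm (K σ)
K-isPerm {σ = σ} σ-perm = isPerm λ {i} {j} Kσi≡Kσj → begin
  i                              ≡⟨ sym (lookup-inverseʳ σ-perm i) ⟩
  lookup σ (lookup (inv σ) i)
    ≡⟨ cong (lookup σ) (cyc-injective (trans (sym (lookup-K σ i)) (trans Kσi≡Kσj (lookup-K σ j)))) ⟩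
  lookup σ (lookup (inv σ) j)    ≡⟨ lookup-inverseʳ σ-perm j ⟩
  j                              ∎

Kpow-isPerm : ∀ {n} t {σ : OneLine n} → IsPerm σ → IsPerm (Kpow t σ)
Kpow-isPerm zero    σ-perm = σ-perm
Kpow-isPerm (suc t) σ-perm = K-isPerm (Kpow-isPerm t σ-perm)

Kpow-+ : ∀ {n} a b (σ : OneLine n) → Kpow (a + b) σ ≡ Kpow a (Kpow b σ)
Kpow-+ zero    b σ = refl
Kpow-+ (suc a) b σ = cong K (Kpow-+ a b σ)

Kpow-comm : ∀ {n} a b (σ : OneLine n) → Kpow a (Kpow b σ) ≡ Kpow b (Kpow a σ)
Kpow-comm a b σ = trans (sym (Kpow-+ a b σ)) (trans (cong (λ t → Kpow t σ) (+-comm a b)) (Kpow-+ b a σ))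

K²-conjugates : ∀ {n} {σ : OneLine n} → IsPerm σ → ∀ i → lookup (K (K σ)) (cyc i) ≡ cyc (lookup σ i)
K²-conjugates {σ = σ} σ-perm i = trans (lookup-K (K σ) (cyc i)) (cong cyc (begin
  lookup (inv (K σ)) (cyc i)                  ≡⟨ cong (lookup (inv (K σ))) (sym Kσ-σi) ⟩
  lookup (inv (K σ)) (lookup (K σ) (lookup σ i)) ≡⟨ lookup-inverseˡ (K-isPerm σ-perm) (lookup σ i) ⟩
  lookup σ i                                  ∎))
  where
  Kσ-σi : lookup (K σ) (lookup σ i) ≡ cyc i
  Kσ-σi = trans (lookup-K σ (lookup σ i)) (cong cyc (lookup-inverseˡ σ-perm i))

Commutes : ∀ {n} → ℕ → OneLine n → Set
Commutes t σ = ∀ i → lookup σ (cyc^ t i) ≡ cyc^ t (lookup σ i)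

K^2t-conjugates : ∀ {n} t {σ : OneLine n} → IsPerm σ →
  ∀ i → lookup (Kpow (2 * t) σ) (cyc^ t i) ≡ cyc^ t (lookup σ i)
K^2t-conjugates zero    σ-perm i = refl
K^2t-conjugates (suc t) {σ} σ-perm i = begin
  lookup (Kpow (2 * suc t) σ) (cyc (cyc^ t i))        ≡⟨ cong (λ s → lookup (Kpow s σ) (cyc (cyc^ t i))) (*-suc 2 t) ⟩
  lookup (K (K (Kpow (2 * t) σ))) (cyc (cyc^ t i))    ≡⟨ K²-conjugates (Kpow-isPerm (2 * t) σ-perm) (cyc^ t i) ⟩
  cyc (lookup (Kpow (2 * t) σ) (cyc^ t i))            ≡⟨ cong cyc (K^2t-conjugates t σ-perm i) ⟩
  cyc (cyc^ t (lookup σ i))                           ∎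

K^2t-fixed⇒Commutes : ∀ {n} t {σ : OneLine n} → IsPerm σ → Kpow (2 * t) σ ≡ σ → Commutes t σ
K^2t-fixed⇒Commutes t σ-perm fixed i =
  trans (cong (λ τ → lookup τ (cyc^ t i)) (sym fixed)) (K^2t-conjugates t σ-perm i)

Commutes⇒K^2t-fixed : ∀ {m} t {σ : OneLine (suc m)} → IsPerm σ → Commutes t σ → Kpow (2 * t) σ ≡ σ
Commutes⇒K^2t-fixed {m} t {σ} σ-perm commutes = lookup-extensionality λ j →
  subst (λ j → lookup (Kpow (2 * t) σ) j ≡ lookup σ j) (cyc^-inverseʳ t j)
    (trans (K^2t-conjugates t σ-perm (cyc^ (m * t) j)) (sym (commutes (cyc^ (m * t) j))))

-- Permutations fixed by K^2k

module FixedPoints (m k′ q′ : ℕ) (N≡q*k : suc m ≡ suc q′ * suc k′) where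

  N k q : ℕ
  N = suc m
  k = suc k′
  q = suc q′

  k≤N : k ≤ N
  k≤N = subst (k ≤_) (sym N≡q*k) (m≤n*m k q)

  residue quotient : Fin N → ℕ
  residue  i = toℕ i % k
  quotient i = toℕ i / k

  quotient<q : ∀ i → quotient i < q
  quotient<q i = m<n*o⇒m/o<n (subst (toℕ i <_) N≡q*k (toℕ<n i))

  rem : Fin N → Fin k
  rem i = fromℕ< (m%n<n (toℕ i) k)

  toℕ-rem : ∀ i → toℕ (rem i) ≡ residue i
  toℕ-rem i = toℕ-fromℕ< (m%n<n (toℕ i) k)

  residue≡⇒rem≡ : ∀ i j → residue i ≡ residue j → rem i ≡ rem j
  residue≡⇒rem≡ i j eq = toℕ-injective (trans (toℕ-rem i) (trans eq (sym (toℕ-rem j))))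

  embed : Fin k → Fin N
  embed r = inject≤ r k≤N

  residue-embed : ∀ r → residue (embed r) ≡ toℕ r
  residue-embed r = trans (cong (_% k) (toℕ-inject≤ r k≤N)) (m<n⇒m%n≡m (toℕ<n r))

  rem-embed : ∀ r → rem (embed r) ≡ r
  rem-embed r = toℕ-injective (trans (toℕ-rem (embed r)) (residue-embed r))

  quotient-embed : ∀ r → quotient (embed r) ≡ 0
  quotient-embed r = trans (cong (_/ k) (toℕ-inject≤ r k≤N)) (m<n⇒m/n≡0 (toℕ<n r))

  residue-cyc^ : ∀ a x → residue (cyc^ (a * k) x) ≡ residue x
  residue-cyc^ a x = begin
    toℕ (cyc^ (a * k) x) % k    ≡⟨ cong (_% k) (toℕ-cyc^ (a * k) x) ⟩
    (toℕ x + a * k) % N % k     ≡⟨ m∣n⇒o%n%m≡o%m k N (toℕ x + a * k) (divides q N≡q*k) ⟩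
    (toℕ x + a * k) % k         ≡⟨ [m+kn]%n≡m%n (toℕ x) a k ⟩
    toℕ x % k                   ∎

  decompose : ∀ i → cyc^ (quotient i * k) (embed (rem i)) ≡ i
  decompose i = toℕ-injective (begin
    toℕ (cyc^ (quotient i * k) (embed (rem i)))     ≡⟨ toℕ-cyc^ (quotient i * k) (embed (rem i)) ⟩
    (toℕ (embed (rem i)) + quotient i * k) % N
      ≡⟨ cong (λ r → (r + quotient i * k) % N) (trans (toℕ-inject≤ (rem i) k≤N) (toℕ-rem i)) ⟩
    (toℕ i % k + toℕ i / k * k) % N                 ≡⟨ cong (_% N) (sym (m≡m%n+[m/n]*n (toℕ i) k)) ⟩
    toℕ i % N                                       ≡⟨ m<n⇒m%n≡m (toℕ<n i) ⟩
    toℕ i                                           ∎)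

  cyc^-q*k : ∀ x → cyc^ (q * k) x ≡ x
  cyc^-q*k x = trans (cong (λ s → cyc^ s x) (trans (sym N≡q*k) (sym (*-identityˡ N)))) (cyc^-multiple {m} 1 x)

  cyc^-complement : ∀ {a} → a ≤ q → ∀ x → cyc^ ((q ∸ a) * k) (cyc^ (a * k) x) ≡ x
  cyc^-complement {a} a≤q x = begin
    cyc^ ((q ∸ a) * k) (cyc^ (a * k) x)   ≡⟨ cyc^-+ ((q ∸ a) * k) (a * k) x ⟩
    cyc^ ((q ∸ a) * k + a * k) x          ≡⟨ cong (λ s → cyc^ s x) (sym (*-distribʳ-+ k (q ∸ a) a)) ⟩
    cyc^ ((q ∸ a + a) * k) x              ≡⟨ cong (λ s → cyc^ (s * k) x) (m∸n+n≡m a≤q) ⟩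
    cyc^ (q * k) x                        ≡⟨ cyc^-q*k x ⟩
    x                                     ∎

  same-rem⇒rotation : ∀ {x y} → rem x ≡ rem y → ∃ λ t → cyc^ (t * k) x ≡ y
  same-rem⇒rotation {x} {y} rx≡ry = quotient y + (q ∸ quotient x) , (begin
    cyc^ ((quotient y + (q ∸ quotient x)) * k) x
      ≡⟨ cong (λ s → cyc^ s x) (*-distribʳ-+ k (quotient y) (q ∸ quotient x)) ⟩
    cyc^ (quotient y * k + (q ∸ quotient x) * k) x
      ≡⟨ sym (cyc^-+ (quotient y * k) ((q ∸ quotient x) * k) x) ⟩
    cyc^ (quotient y * k) (cyc^ ((q ∸ quotient x) * k) x)
      ≡⟨ cong (cyc^ (quotient y * k) ∘ cyc^ ((q ∸ quotient x) * k)) (sym (decompose x)) ⟩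
    cyc^ (quotient y * k) (cyc^ ((q ∸ quotient x) * k) (cyc^ (quotient x * k) (embed (rem x))))
      ≡⟨ cong (cyc^ (quotient y * k)) (cyc^-complement (<⇒≤ (quotient<q x)) (embed (rem x))) ⟩
    cyc^ (quotient y * k) (embed (rem x))
      ≡⟨ cong (cyc^ (quotient y * k) ∘ embed) rx≡ry ⟩
    cyc^ (quotient y * k) (embed (rem y))
      ≡⟨ decompose y ⟩
    y ∎)

  rotations-differ : ∀ {a b} → a < b → b < q → ∀ x → cyc^ (a * k) x ≢ cyc^ (b * k) x
  rotations-differ {a} {b} a<b b<q x eq = cyc^-fixed-point-free 0<d d<N (cyc^ (a * k) x) (begin
    cyc^ d (cyc^ (a * k) x)       ≡⟨ cyc^-+ d (a * k) x ⟩
    cyc^ (d + a * k) x            ≡⟨ cong (λ s → cyc^ s x) (sym (*-distribʳ-+ k (b ∸ a) a)) ⟩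
    cyc^ ((b ∸ a + a) * k) x      ≡⟨ cong (λ s → cyc^ (s * k) x) (m∸n+n≡m (<⇒≤ a<b)) ⟩
    cyc^ (b * k) x                ≡⟨ sym eq ⟩
    cyc^ (a * k) x                ∎)
    where
    d = (b ∸ a) * k
    0<d : 0 < d
    0<d = <-≤-trans z<s (m≤n*m k (b ∸ a) {{>-nonZero (m<n⇒0<n∸m a<b)}})
    d<N : d < N
    d<N = subst (d <_) (sym N≡q*k) (*-monoˡ-< k (≤-<-trans (m∸n≤m b a) b<q))

  cyc^-multiple-injective : ∀ {a b} → a < q → b < q → ∀ x → cyc^ (a * k) x ≡ cyc^ (b * k) x → a ≡ b
  cyc^-multiple-injective {a} {b} a<q b<q x eq with <-cmp a b
  ... | tri≈ _ a≡b _ = a≡b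
  ... | tri< a<b _ _ = contradiction eq (rotations-differ a<b b<q x)
  ... | tri> _ _ b<a = contradiction (sym eq) (rotations-differ b<a a<q x)

  rem-cyc^ : ∀ a x → rem (cyc^ (a * k) x) ≡ rem x
  rem-cyc^ a x = residue≡⇒rem≡ (cyc^ (a * k) x) x (residue-cyc^ a x)

  Commutes-multiple : ∀ (σ : OneLine N) → Commutes k σ → ∀ t → Commutes (t * k) σ
  Commutes-multiple σ commutes zero    i = refl
  Commutes-multiple σ commutes (suc t) i = begin
    lookup σ (cyc^ (k + t * k) i)            ≡⟨ cong (lookup σ) (sym (cyc^-+ k (t * k) i)) ⟩
    lookup σ (cyc^ k (cyc^ (t * k) i))       ≡⟨ commutes (cyc^ (t * k) i) ⟩
    cyc^ k (lookup σ (cyc^ (t * k) i))       ≡⟨ cong (cyc^ k) (Commutes-multiple σ commutes t i) ⟩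
    cyc^ k (cyc^ (t * k) (lookup σ i))       ≡⟨ cyc^-+ k (t * k) (lookup σ i) ⟩
    cyc^ (k + t * k) (lookup σ i)            ∎

  restrict : OneLine N → Vec (Fin N) k
  restrict σ = Vec.tabulate (lookup σ ∘ embed)

  extend : Vec (Fin N) k → OneLine N
  extend w = Vec.tabulate λ i → cyc^ (quotient i * k) (lookup w (rem i))

  lookup-restrict : ∀ σ r → lookup (restrict σ) r ≡ lookup σ (embed r)
  lookup-restrict σ = lookup∘tabulate (lookup σ ∘ embed)

  lookup-extend : ∀ w i → lookup (extend w) i ≡ cyc^ (quotient i * k) (lookup w (rem i))
  lookup-extend w = lookup∘tabulate λ i → cyc^ (quotient i * k) (lookup w (rem i))

  restrict-extend : ∀ w → restrict (extend w) ≡ w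
  restrict-extend w = lookup-extensionality λ r → begin
    lookup (restrict (extend w)) r                                  ≡⟨ lookup-restrict (extend w) r ⟩
    lookup (extend w) (embed r)                                     ≡⟨ lookup-extend w (embed r) ⟩
    cyc^ (quotient (embed r) * k) (lookup w (rem (embed r)))
      ≡⟨ cong₂ (λ a r → cyc^ (a * k) (lookup w r)) (quotient-embed r) (rem-embed r) ⟩
    lookup w r                                                      ∎

  extend-restrict : ∀ {σ} → Commutes k σ → extend (restrict σ) ≡ σ
  extend-restrict {σ} commutes = lookup-extensionality λ i → begin
    lookup (extend (restrict σ)) i                       ≡⟨ lookup-extend (restrict σ) i ⟩
    cyc^ (quotient i * k) (lookup (restrict σ) (rem i))  ≡⟨ cong (cyc^ (quotient i * k)) (lookup-restrict σ (rem i)) ⟩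
    cyc^ (quotient i * k) (lookup σ (embed (rem i)))     ≡⟨ Commutes-multiple σ commutes (quotient i) (embed (rem i)) ⟨
    lookup σ (cyc^ (quotient i * k) (embed (rem i)))     ≡⟨ cong (lookup σ) (decompose i) ⟩
    lookup σ i                                           ∎

  extend-commutes : ∀ w → Commutes k (extend w)
  extend-commutes w i = begin
    lookup (extend w) (cyc^ k i)                          ≡⟨ lookup-extend w (cyc^ k i) ⟩
    cyc^ (quotient (cyc^ k i) * k) (lookup w (rem (cyc^ k i)))
                                                          ≡⟨ cong (cyc^ (quotient (cyc^ k i) * k) ∘ lookup w) rem-shift ⟩
    cyc^ (quotient (cyc^ k i) * k) x
      ≡⟨ cyc^-determined-by-point (quotient (cyc^ k i) * k) (k + quotient i * k) same-at-embed x ⟩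
    cyc^ (k + quotient i * k) x                           ≡⟨ sym (cyc^-+ k (quotient i * k) x) ⟩
    cyc^ k (cyc^ (quotient i * k) x)                      ≡⟨ cong (cyc^ k) (sym (lookup-extend w i)) ⟩
    cyc^ k (lookup (extend w) i)                          ∎
    where
    x = lookup w (rem i)
    cyc^-k : ∀ y → cyc^ k y ≡ cyc^ (1 * k) y
    cyc^-k y = cong (λ s → cyc^ s y) (sym (*-identityˡ k))
    rem-shift : rem (cyc^ k i) ≡ rem i
    rem-shift = trans (cong rem (cyc^-k i)) (rem-cyc^ 1 i)
    same-at-embed : cyc^ (quotient (cyc^ k i) * k) (embed (rem i)) ≡ cyc^ (k + quotient i * k) (embed (rem i))
    same-at-embed = begin
      cyc^ (quotient (cyc^ k i) * k) (embed (rem i))          ≡⟨ cong (cyc^ (quotient (cyc^ k i) * k) ∘ embed) (sym rem-shift) ⟩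
      cyc^ (quotient (cyc^ k i) * k) (embed (rem (cyc^ k i))) ≡⟨ decompose (cyc^ k i) ⟩
      cyc^ k i                                                ≡⟨ cong (cyc^ k) (sym (decompose i)) ⟩
      cyc^ k (cyc^ (quotient i * k) (embed (rem i)))          ≡⟨ cyc^-+ k (quotient i * k) (embed (rem i)) ⟩
      cyc^ (k + quotient i * k) (embed (rem i))               ∎

  DistinctResidues : ∀ {l} → Vec (Fin N) l → Set
  DistinctResidues w = ∀ {r r′} → residue (lookup w r) ≡ residue (lookup w r′) → r ≡ r′

  restrict-distinct : ∀ {σ} → IsPerm σ → Commutes k σ → DistinctResidues (restrict σ)
  restrict-distinct {σ} σ-perm commutes {r} {r′} same-residue = begin
    r                             ≡⟨ sym (rem-embed r) ⟩
    rem (embed r)                 ≡⟨ sym (rem-cyc^ t (embed r)) ⟩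
    rem (cyc^ (t * k) (embed r))  ≡⟨ cong rem (IsPerm.injective σ-perm σ-rotated) ⟩
    rem (embed r′)                ≡⟨ rem-embed r′ ⟩
    r′                            ∎
    where
    same-rem : rem (lookup σ (embed r)) ≡ rem (lookup σ (embed r′))
    same-rem = residue≡⇒rem≡ (lookup σ (embed r)) (lookup σ (embed r′))
      (subst₂ (λ a b → residue a ≡ residue b) (lookup-restrict σ r) (lookup-restrict σ r′) same-residue)
    rotation = same-rem⇒rotation {lookup σ (embed r)} {lookup σ (embed r′)} same-rem
    t = proj₁ rotation
    σ-rotated : lookup σ (cyc^ (t * k) (embed r)) ≡ lookup σ (embed r′)
    σ-rotated = trans (Commutes-multiple σ commutes t (embed r)) (proj₂ rotation)

  extend-isPerm : ∀ {w} → DistinctResidues w → IsPerm (extend w)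
  extend-isPerm {w} distinct = isPerm λ {i} {j} ext-i≡ext-j →
    let rotated : cyc^ (quotient i * k) (lookup w (rem i)) ≡ cyc^ (quotient j * k) (lookup w (rem j))
        rotated = trans (sym (lookup-extend w i)) (trans ext-i≡ext-j (lookup-extend w j))
        rem-i≡rem-j : rem i ≡ rem j
        rem-i≡rem-j = distinct (begin
          residue (lookup w (rem i))                                  ≡⟨ sym (residue-cyc^ (quotient i) _) ⟩
          residue (cyc^ (quotient i * k) (lookup w (rem i)))          ≡⟨ cong residue rotated ⟩
          residue (cyc^ (quotient j * k) (lookup w (rem j)))          ≡⟨ residue-cyc^ (quotient j) _ ⟩
          residue (lookup w (rem j))                                  ∎)
        quotient-i≡quotient-j : quotient i ≡ quotient j
        quotient-i≡quotient-j = cyc^-multiple-injective (quotient<q i) (quotient<q j) (lookup w (rem i))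
          (trans rotated (cong (λ r → cyc^ (quotient j * k) (lookup w r)) (sym rem-i≡rem-j)))
    in begin
      i                                          ≡⟨ sym (decompose i) ⟩
      cyc^ (quotient i * k) (embed (rem i))
        ≡⟨ cong₂ (λ a r → cyc^ (a * k) (embed r)) quotient-i≡quotient-j rem-i≡rem-j ⟩
      cyc^ (quotient j * k) (embed (rem j))      ≡⟨ decompose j ⟩
      j                                          ∎

  freshᵇ : ∀ {l} → List ℕ → Vec (Fin N) l → Bool
  freshᵇ used []      = true
  freshᵇ used (x ∷ w) = not (residue x ∈ᵇ used) ∧ freshᵇ (residue x ∷ used) w

  fresh⇒distinct : ∀ {l} used (w : Vec (Fin N) l) → T (freshᵇ used w) →
    (∀ r → residue (lookup w r) ∉ used) × DistinctResidues w
  fresh⇒distinct used []      _     = (λ ()) , λ {r} → contradiction r λ ()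
  fresh⇒distinct used (x ∷ w) fresh = avoids , distinct
    where
    x-new = proj₁ (Equivalence.to T-∧ fresh)
    w-fresh = fresh⇒distinct (residue x ∷ used) w (proj₂ (Equivalence.to T-∧ fresh))
    avoids : ∀ r → residue (lookup (x ∷ w) r) ∉ used
    avoids Fin.zero    = not-∈ᵇ⇒∉ x-new
    avoids (Fin.suc r) = proj₁ w-fresh r ∘ there
    distinct : DistinctResidues (x ∷ w)
    distinct {Fin.zero}  {Fin.zero}   _  = refl
    distinct {Fin.zero}  {Fin.suc r′} eq = contradiction (here (sym eq)) (proj₁ w-fresh r′)
    distinct {Fin.suc r} {Fin.zero}   eq = contradiction (here eq) (proj₁ w-fresh r)
    distinct {Fin.suc r} {Fin.suc r′} eq = cong Fin.suc (proj₂ w-fresh eq)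

  distinct⇒fresh : ∀ {l} used (w : Vec (Fin N) l) → (∀ r → residue (lookup w r) ∉ used) →
    DistinctResidues w → T (freshᵇ used w)
  distinct⇒fresh used []      _      _        = _
  distinct⇒fresh used (x ∷ w) avoids distinct = Equivalence.from T-∧
    (∉⇒not-∈ᵇ (avoids Fin.zero) , distinct⇒fresh (residue x ∷ used) w w-avoids (Fin.suc-injective ∘ distinct))
    where
    w-avoids : ∀ r → residue (lookup w r) ∉ residue x ∷ used
    w-avoids r (here eq)      = contradiction (distinct {Fin.suc r} {Fin.zero} eq) λ ()
    w-avoids r (there r∈used) = avoids (Fin.suc r) r∈used

  avoiding-count : ∀ used → Unique used → All (_< k) used →
    length (filterᵇ (λ i → not (residue i ∈ᵇ used)) (allFin N)) ≡ q * (k ∸ length used)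
  avoiding-count used used-unique used<k = begin
    length (filterᵇ (λ i → not (residue i ∈ᵇ used)) (allFin N))  ≡⟨ length-filterᵇ-allFin (not ∘ hits) N ⟩
    countBelow (not ∘ hits) N                                    ≡⟨ sym (m+n∸m≡n (countBelow hits N) _) ⟩
    countBelow hits N + countBelow (not ∘ hits) N ∸ countBelow hits N
                                                                 ≡⟨ cong₂ _∸_ (countBelow-complement hits N) hits-count ⟩
    N ∸ q * length used                                          ≡⟨ cong (_∸ q * length used) N≡q*k ⟩
    q * k ∸ q * length used                                      ≡⟨ sym (*-distribˡ-∸ q k (length used)) ⟩
    q * (k ∸ length used)                                        ∎
    where
    hits : ℕ → Bool
    hits x = x % k ∈ᵇ used
    hits-count : countBelow hits N ≡ q * length used
    hits-count = begin
      countBelow hits N                   ≡⟨ cong (countBelow hits) N≡q*k ⟩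
      countBelow hits (q * k)
        ≡⟨ countBelow-periodic hits k q (λ x → cong (_∈ᵇ used) (trans (cong (_% k) (+-comm k x)) ([m+n]%n≡m%n x k))) ⟩
      q * countBelow hits k               ≡⟨ cong (q *_) (countBelow-cong k λ x<k → cong (_∈ᵇ used) (m<n⇒m%n≡m x<k)) ⟩
      q * countBelow (_∈ᵇ used) k         ≡⟨ cong (q *_) (countBelow-member used used-unique used<k) ⟩
      q * length used                     ∎

  wordCount : ℕ → ℕ → ℕ
  wordCount zero    j = 1
  wordCount (suc l) j = q * (k ∸ j) * wordCount l (suc j)

  fresh-count : ∀ l used → Unique used → All (_< k) used →
    length (filterᵇ (freshᵇ used) (allVecs l)) ≡ wordCount l (length used)
  fresh-count zero    used _           _      = refl
  fresh-count (suc l) used used-unique used<k = begin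
    length (filterᵇ (freshᵇ used) (allVecs (suc l)))
      ≡⟨ cong (length ∘ filterᵇ (freshᵇ used)) (concatMap-map≡cartesianProductWith _∷_ (allFin N) (allVecs l)) ⟩
    length (filterᵇ (freshᵇ used) (cartesianProductWith _∷_ (allFin N) (allVecs l)))
      ≡⟨ length-filterᵇ-cartesianProductWith _∷_ (freshᵇ used) (allFin N) (allVecs l) ⟩
    sum (map (λ i → length (filterᵇ (freshᵇ used ∘ (i ∷_)) (allVecs l))) (allFin N))
      ≡⟨ sum-map-indicator avoids (wordCount l (suc (length used))) _ (allFin N) extensions ⟩
    length (filterᵇ avoids (allFin N)) * wordCount l (suc (length used))
      ≡⟨ cong (_* wordCount l (suc (length used))) (avoiding-count used used-unique used<k) ⟩
    q * (k ∸ length used) * wordCount l (suc (length used))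
      ∎
    where
    avoids : Fin N → Bool
    avoids i = not (residue i ∈ᵇ used)
    extensions : ∀ i → length (filterᵇ (λ w → avoids i ∧ freshᵇ (residue i ∷ used) w) (allVecs l))
                       ≡ (if avoids i then wordCount l (suc (length used)) else 0)
    extensions i with residue i ∈ᵇ used in hit
    ... | true  = length-filterᵇ-false (allVecs l)
    ... | false = fresh-count l (residue i ∷ used)
      (¬Any⇒All¬ used (not-∈ᵇ⇒∉ (subst (T ∘ not) (sym hit) _)) ∷ used-unique)
      (m%n<n (toℕ i) k All.∷ used<k)

  wordCount-closed : ∀ l j → j + l ≡ k → wordCount l j ≡ q ^ l * l !
  wordCount-closed zero    j _        = refl
  wordCount-closed (suc l) j j+l+1≡k = begin
    q * (k ∸ j) * wordCount l (suc j)
      ≡⟨ cong₂ (λ a b → q * a * b) k∸j≡l+1 (wordCount-closed l (suc j) (trans (sym (+-suc j l)) j+l+1≡k)) ⟩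
    q * suc l * (q ^ l * l !)            ≡⟨ rearrange q l (q ^ l) (l !) ⟩
    q * q ^ l * (suc l * l !)            ∎
    where
    k∸j≡l+1 : k ∸ j ≡ suc l
    k∸j≡l+1 = trans (cong (_∸ j) (sym j+l+1≡k)) (m+n∸m≡n j (suc l))
    rearrange : ∀ q l p f → q * suc l * (p * f) ≡ q * p * (suc l * f)
    rearrange = solve-∀

  fixedᵇ : OneLine N → Bool
  fixedᵇ σ = vecEqᵇ (Kpow (2 * k) σ) σ

  fixed : List (OneLine N)
  fixed = filterᵇ fixedᵇ (Sn N)

  words : List (Vec (Fin N) k)
  words = filterᵇ (freshᵇ []) (allVecs k)

  ∈-fixed⁻ : ∀ {σ} → σ ∈ fixed → IsPerm σ × Commutes k σ
  ∈-fixed⁻ {σ} σ∈fixed =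
    let σ∈Sn , σ-fixed = ∈-filter⁻ (T? ∘ fixedᵇ) {xs = Sn N} σ∈fixed
        σ-perm = ∈-Sn⁻ σ∈Sn
    in σ-perm , K^2t-fixed⇒Commutes k σ-perm (vecEqᵇ⇒≡ σ-fixed)

  ∈-fixed⁺ : ∀ {σ} → IsPerm σ → Commutes k σ → σ ∈ fixed
  ∈-fixed⁺ {σ} σ-perm commutes =
    ∈-filter⁺ (T? ∘ fixedᵇ) (∈-Sn⁺ σ-perm) (≡⇒vecEqᵇ (Commutes⇒K^2t-fixed k σ-perm commutes))

  ∈-words⁻ : ∀ {w} → w ∈ words → DistinctResidues w
  ∈-words⁻ {w} w∈words = proj₂ (fresh⇒distinct [] w (proj₂ (∈-filter⁻ (T? ∘ freshᵇ []) {xs = allVecs k} w∈words)))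

  ∈-words⁺ : ∀ {w} → DistinctResidues w → w ∈ words
  ∈-words⁺ {w} distinct = ∈-filter⁺ (T? ∘ freshᵇ []) (∈-allVecs k w) (distinct⇒fresh [] w (λ _ ()) distinct)

  length-fixed≡length-words : length fixed ≡ length words
  length-fixed≡length-words = trans
    (unique-⊆-antisym⇒length-≡ (filter⁺ (T? ∘ fixedᵇ) (Sn-unique N)) extended-unique fixed⊆extended extended⊆fixed)
    (length-map extend words)
    where
    extended-unique : Unique (map extend words)
    extended-unique = map⁺ (λ eq → trans (sym (restrict-extend _)) (trans (cong restrict eq) (restrict-extend _)))
                           (filter⁺ (T? ∘ freshᵇ []) (allVecs-unique k))
    fixed⊆extended : fixed ⊆ map extend words
    fixed⊆extended {σ} σ∈fixed =
      let σ-perm , commutes = ∈-fixed⁻ σ∈fixed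
      in subst (_∈ map extend words) (extend-restrict commutes)
           (∈-map⁺ extend (∈-words⁺ {restrict σ} (restrict-distinct σ-perm commutes)))
    extended⊆fixed : map extend words ⊆ fixed
    extended⊆fixed σ∈extended =
      let w , w∈words , σ≡extend-w = ∈-map⁻ extend σ∈extended
      in subst (_∈ fixed) (sym σ≡extend-w) (∈-fixed⁺ (extend-isPerm {w} (∈-words⁻ w∈words)) (extend-commutes w))

  numFixedBy-K^2k : numFixedBy N (2 * k) ≡ q ^ k * k !
  numFixedBy-K^2k = begin
    length fixed            ≡⟨ length-fixed≡length-words ⟩
    length words            ≡⟨ fresh-count k [] [] All.[] ⟩
    wordCount k 0           ≡⟨ wordCount-closed k 0 refl ⟩
    q ^ k * k !             ∎

-- Orbits of K

search-least : ∀ {P : ℕ → Set} → Decidable P → ∀ N →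
  (∃ λ d → d < N × P d × (∀ {e} → e < d → ¬ P e)) ⊎ (∀ {e} → e < N → ¬ P e)
search-least P? zero = inj₂ λ ()
search-least P? (suc N) with search-least P? N
... | inj₁ (d , d<N , Pd , below-d) = inj₁ (d , m<n⇒m<1+n d<N , Pd , below-d)
... | inj₂ none-below with P? N
...   | yes PN = inj₁ (N , n<1+n N , PN , none-below)
...   | no ¬PN = inj₂ λ e<1+N → case m<1+n⇒m<n∨m≡n e<1+N of λ
          { (inj₁ e<N) → none-below e<N
          ; (inj₂ refl) → ¬PN }

module _ {n : ℕ} where

  record HasOrbitSize (d : ℕ) (σ : OneLine n) : Set where
    field
      positive : 0 < d
      periodic : Kpow d σ ≡ σ
      minimal  : ∀ {e} → 0 < e → e < d → Kpow e σ ≢ σ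

  Kpow-multiple : ∀ {d} {σ : OneLine n} → Kpow d σ ≡ σ → ∀ s → Kpow (s * d) σ ≡ σ
  Kpow-multiple         periodic zero    = refl
  Kpow-multiple {d} {σ} periodic (suc s) =
    trans (Kpow-+ d (s * d) σ) (trans (cong (Kpow d) (Kpow-multiple periodic s)) periodic)

  Kpow-mod : ∀ {d} {σ : OneLine n} .{{_ : NonZero d}} → Kpow d σ ≡ σ → ∀ a → Kpow (a % d) σ ≡ Kpow a σ
  Kpow-mod {d} {σ} periodic a = begin
    Kpow (a % d) σ                       ≡⟨ cong (Kpow (a % d)) (sym (Kpow-multiple periodic (a / d))) ⟩
    Kpow (a % d) (Kpow (a / d * d) σ)    ≡⟨ sym (Kpow-+ (a % d) (a / d * d) σ) ⟩
    Kpow (a % d + a / d * d) σ           ≡⟨ cong (λ b → Kpow b σ) (sym (m≡m%n+[m/n]*n a d)) ⟩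
    Kpow a σ                             ∎

  Kpow-preserves-periodic : ∀ {e} {σ : OneLine n} a → Kpow e σ ≡ σ → Kpow e (Kpow a σ) ≡ Kpow a σ
  Kpow-preserves-periodic {e} {σ} a periodic = trans (Kpow-comm e a σ) (cong (Kpow a) periodic)

  Kpow-reflects-periodic : ∀ {d e} {σ : OneLine n} → 0 < d → Kpow d σ ≡ σ →
    ∀ a → Kpow e (Kpow a σ) ≡ Kpow a σ → Kpow e σ ≡ σ
  Kpow-reflects-periodic {d} {e} {σ} 0<d periodic a e-periodic = begin
    Kpow e σ                 ≡⟨ cong (Kpow e) (sym back) ⟩
    Kpow e (Kpow b τ)        ≡⟨ Kpow-comm e b τ ⟩
    Kpow b (Kpow e τ)        ≡⟨ cong (Kpow b) e-periodic ⟩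
    Kpow b τ                 ≡⟨ back ⟩
    σ                        ∎
    where
    τ = Kpow a σ
    b = pred d * a
    back : Kpow b τ ≡ σ
    back = begin
      Kpow b (Kpow a σ)          ≡⟨ sym (Kpow-+ b a σ) ⟩
      Kpow (pred d * a + a) σ
        ≡⟨ cong (λ c → Kpow c σ) (trans (+-comm (pred d * a) a)
                                  (trans (cong (_* a) (suc-pred d {{>-nonZero 0<d}})) (*-comm d a))) ⟩
      Kpow (a * d) σ             ≡⟨ Kpow-multiple periodic a ⟩
      σ                          ∎

  HasOrbitSize-Kpow : ∀ {d} {σ : OneLine n} → HasOrbitSize d σ → ∀ a → HasOrbitSize d (Kpow a σ)
  HasOrbitSize-Kpow {d} size a = record
    { positive = positive
    ; periodic = Kpow-preserves-periodic {e = d} a periodic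
    ; minimal  = λ {e} 0<e e<d → minimal 0<e e<d ∘ Kpow-reflects-periodic {e = e} positive periodic a
    }
    where open HasOrbitSize size

  least-period : ∀ {M} {σ : OneLine n} → 0 < M → Kpow M σ ≡ σ → ∃ λ d → d ≤ M × HasOrbitSize d σ
  least-period {suc M} {σ} _ periodic with search-least (λ e → Kpow (suc e) σ ≟ σ) (suc M)
  ... | inj₁ (d , s≤s d≤M , d+1-periodic , below) = suc d , s≤s d≤M , record
    { positive = z<s
    ; periodic = d+1-periodic
    ; minimal  = λ { {suc e} _ (s<s e<d) → below e<d }
    }
  ... | inj₂ none = contradiction periodic (none (n<1+n M))

  orbitSize-∣ : ∀ {d M} {σ : OneLine n} → HasOrbitSize d σ → Kpow M σ ≡ σ → d ∣ M
  orbitSize-∣ {d} {M} {σ} size M-periodic = divides (M / d) (begin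
    M                    ≡⟨ m≡m%n+[m/n]*n M d ⟩
    M % d + M / d * d    ≡⟨ cong (_+ M / d * d) M%d≡0 ⟩
    M / d * d            ∎)
    where
    open HasOrbitSize size
    instance _ = >-nonZero positive
    M%d≡0 : M % d ≡ 0
    M%d≡0 with M % d in eq | m%n<n M d
    ... | zero  | _       = refl
    ... | suc r | 1+r<d   = contradiction (trans (cong (λ c → Kpow c σ) (sym eq)) (trans (Kpow-mod periodic M) M-periodic))
                                          (minimal z<s 1+r<d)

  orbitSizeIsᵇ⇒HasOrbitSize : ∀ d (σ : OneLine n) → T (orbitSizeIsᵇ d σ) → HasOrbitSize d σ
  orbitSizeIsᵇ⇒HasOrbitSize (suc d) σ ok = record
    { positive = z<s
    ; periodic = vecEqᵇ⇒≡ (proj₁ (Equivalence.to T-∧ ok))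
    ; minimal  = λ { {suc e} _ (s<s e<d) → not-vecEqᵇ⇒≢ (T-all-lookup (λ e → not (vecEqᵇ (Kpow (suc e) σ) σ)) (upTo d)
                                                          (proj₂ (Equivalence.to T-∧ ok)) (∈-upTo⁺ e<d)) }
    }

  HasOrbitSize⇒orbitSizeIsᵇ : ∀ {d} {σ : OneLine n} → HasOrbitSize d σ → T (orbitSizeIsᵇ d σ)
  HasOrbitSize⇒orbitSizeIsᵇ {suc d} {σ} size = Equivalence.from T-∧
    ( ≡⇒vecEqᵇ periodic
    , T-all-tabulate (λ e → not (vecEqᵇ (Kpow (suc e) σ) σ)) (upTo d)
        (λ e∈ → ≢⇒not-vecEqᵇ (minimal z<s (s<s (∈-upTo⁻ e∈)))) )
    where open HasOrbitSize size

  Kpow-no-repeat : ∀ {d} {σ : OneLine n} → HasOrbitSize d σ → ∀ {i j} → i < j → j < d → Kpow i σ ≢ Kpow j σ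
  Kpow-no-repeat {d} {σ} size {i} {j} i<j j<d eq =
    minimal (m<n⇒0<n∸m i<j) (≤-<-trans (m∸n≤m j i) j<d) (Kpow-reflects-periodic {e = j ∸ i} positive periodic i (begin
      Kpow (j ∸ i) (Kpow i σ)   ≡⟨ sym (Kpow-+ (j ∸ i) i σ) ⟩
      Kpow (j ∸ i + i) σ        ≡⟨ cong (λ c → Kpow c σ) (m∸n+n≡m (<⇒≤ i<j)) ⟩
      Kpow j σ                  ≡⟨ sym eq ⟩
      Kpow i σ                  ∎))
    where open HasOrbitSize size

  Kpow-injective-below : ∀ {d} {σ : OneLine n} → HasOrbitSize d σ →
    ∀ {i j} → i < d → j < d → Kpow i σ ≡ Kpow j σ → i ≡ j
  Kpow-injective-below size {i} {j} i<d j<d eq with <-cmp i j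
  ... | tri≈ _ i≡j _ = i≡j
  ... | tri< i<j _ _ = contradiction eq (Kpow-no-repeat size i<j j<d)
  ... | tri> _ _ j<i = contradiction (sym eq) (Kpow-no-repeat size j<i i<d)

dividesᵇ⇒∣ : ∀ {d M} → T (dividesᵇ d M) → d ∣ M
dividesᵇ⇒∣ {d} {M} ok = let q , _ , q*d≡M = T-any-find (λ q → q * d ≡ᵇ M) (upTo (suc M)) ok
                       in divides q (sym (≡ᵇ⇒≡ (q * d) M q*d≡M))

∣⇒dividesᵇ : ∀ {d M} → 0 < d → d ∣ M → T (dividesᵇ d M)
∣⇒dividesᵇ {d} {M} 0<d (divides q M≡q*d) = T-any-lose (λ q → q * d ≡ᵇ M) (upTo (suc M))
  (∈-upTo⁺ (s≤s (subst (q ≤_) (sym M≡q*d) (m≤m*n q d {{>-nonZero 0<d}}))))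
  (≡⇒≡ᵇ (q * d) M (sym M≡q*d))

module _ {n M : ℕ} (0<M : 0 < M) where

  properDivisorOrbitᵇ : OneLine n → Bool
  properDivisorOrbitᵇ σ = any (λ d → dividesᵇ d M ∧ orbitSizeIsᵇ d σ) (upTo M)

  proper-divisor-orbit : ∀ {d} {σ : OneLine n} → d < M → d ∣ M → HasOrbitSize d σ → T (properDivisorOrbitᵇ σ)
  proper-divisor-orbit {d} {σ} d<M d∣M size =
    T-any-lose (λ d → dividesᵇ d M ∧ orbitSizeIsᵇ d σ) (upTo M) (∈-upTo⁺ d<M)
      (Equivalence.from T-∧ (∣⇒dividesᵇ (HasOrbitSize.positive size) d∣M , HasOrbitSize⇒orbitSizeIsᵇ size))

  periodic⇒orbitSize∣ : ∀ {σ : OneLine n} → T (vecEqᵇ (Kpow M σ) σ) → T (orbitSizeIsᵇ M σ ∨ properDivisorOrbitᵇ σ)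
  periodic⇒orbitSize∣ {σ} M-periodic with least-period 0<M (vecEqᵇ⇒≡ M-periodic)
  ... | d , d≤M , size with m≤n⇒m<n∨m≡n d≤M
  ...   | inj₂ refl = Equivalence.from T-∨ (inj₁ (HasOrbitSize⇒orbitSizeIsᵇ size))
  ...   | inj₁ d<M  = Equivalence.from T-∨
    (inj₂ (proper-divisor-orbit d<M (orbitSize-∣ {M = M} size (vecEqᵇ⇒≡ M-periodic)) size))

  orbitSize∣⇒periodic : ∀ {σ : OneLine n} → T (orbitSizeIsᵇ M σ ∨ properDivisorOrbitᵇ σ) → T (vecEqᵇ (Kpow M σ) σ)
  orbitSize∣⇒periodic {σ} ok with Equivalence.to T-∨ ok
  ... | inj₁ exact  = ≡⇒vecEqᵇ (HasOrbitSize.periodic (orbitSizeIsᵇ⇒HasOrbitSize M σ exact))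
  ... | inj₂ proper =
    let d , _ , d-ok = T-any-find (λ d → dividesᵇ d M ∧ orbitSizeIsᵇ d σ) (upTo M) proper
        d∣M , d-size = Equivalence.to T-∧ d-ok
        divides q M≡q*d = dividesᵇ⇒∣ {d} {M} d∣M
    in ≡⇒vecEqᵇ (subst (λ c → Kpow c σ ≡ σ) (sym M≡q*d)
                  (Kpow-multiple (HasOrbitSize.periodic (orbitSizeIsᵇ⇒HasOrbitSize d σ d-size)) q))

  orbitSize-exclusive : ∀ {σ : OneLine n} → T (orbitSizeIsᵇ M σ) → ¬ T (properDivisorOrbitᵇ σ)
  orbitSize-exclusive {σ} exact proper =
    let d , d∈upTo , d-ok = T-any-find (λ d → dividesᵇ d M ∧ orbitSizeIsᵇ d σ) (upTo M) proper
        d-size = orbitSizeIsᵇ⇒HasOrbitSize d σ (proj₂ (Equivalence.to T-∧ d-ok))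
    in HasOrbitSize.minimal (orbitSizeIsᵇ⇒HasOrbitSize M σ exact) (HasOrbitSize.positive d-size) (∈-upTo⁻ d∈upTo)
         (HasOrbitSize.periodic d-size)

  numFixedBy-partition : numFixedBy n M ≡ length (filterᵇ (orbitSizeIsᵇ M) (Sn n)) + numInProperDivisorOrbits n M
  numFixedBy-partition = trans
    (cong length (filter-≐ (T? ∘ λ σ → vecEqᵇ (Kpow M σ) σ) (T? ∘ λ σ → orbitSizeIsᵇ M σ ∨ properDivisorOrbitᵇ σ)
                           (periodic⇒orbitSize∣ , orbitSize∣⇒periodic) (Sn n)))
    (length-filterᵇ-disjoint-∨ (orbitSizeIsᵇ M) properDivisorOrbitᵇ (Sn n) λ _ → orbitSize-exclusive)

module OrbitCount {n M : ℕ} (0<M : 0 < M) where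

  private instance
    M≢0 : NonZero M
    M≢0 = >-nonZero 0<M

  orbit : OneLine n → List (OneLine n)
  orbit σ = map (λ j → Kpow j σ) (upTo M)

  ∈-orbit : ∀ {σ} → Kpow M σ ≡ σ → ∀ a → Kpow a σ ∈ orbit σ
  ∈-orbit {σ} periodic a = subst (_∈ orbit σ) (Kpow-mod periodic a) (∈-map⁺ (λ j → Kpow j σ) (∈-upTo⁺ (m%n<n a M)))

  orbit-trans : ∀ {σ τ υ} → Kpow M σ ≡ σ → τ ∈ orbit σ → υ ∈ orbit τ → υ ∈ orbit σ
  orbit-trans {σ} {τ} periodic τ∈orbit-σ υ∈orbit-τ =
    let i , _ , τ≡σ^i = ∈-map⁻ (λ j → Kpow j σ) τ∈orbit-σ
        j , _ , υ≡τ^j = ∈-map⁻ (λ j → Kpow j τ) υ∈orbit-τ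
    in subst (_∈ orbit σ) (sym (trans υ≡τ^j (trans (cong (Kpow j) τ≡σ^i) (sym (Kpow-+ j i σ))))) (∈-orbit periodic (j + i))

  orbit-sym : ∀ {σ τ} → Kpow M σ ≡ σ → τ ∈ orbit σ → σ ∈ orbit τ
  orbit-sym {σ} {τ} periodic τ∈orbit-σ =
    let i , i∈upTo , τ≡σ^i = ∈-map⁻ (λ j → Kpow j σ) τ∈orbit-σ
        σ≡τ^[M-i] = begin
          σ                        ≡⟨ sym periodic ⟩
          Kpow M σ                 ≡⟨ cong (λ c → Kpow c σ) (sym (m∸n+n≡m (<⇒≤ (∈-upTo⁻ i∈upTo)))) ⟩
          Kpow (M ∸ i + i) σ       ≡⟨ Kpow-+ (M ∸ i) i σ ⟩
          Kpow (M ∸ i) (Kpow i σ)  ≡⟨ cong (Kpow (M ∸ i)) (sym τ≡σ^i) ⟩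
          Kpow (M ∸ i) τ           ∎
        τ-periodic = subst (λ υ → Kpow M υ ≡ υ) (sym τ≡σ^i) (Kpow-preserves-periodic {e = M} i periodic)
    in subst (_∈ orbit τ) (sym σ≡τ^[M-i]) (∈-orbit τ-periodic (M ∸ i))

  IsOrbitRep : OneLine n → Set
  IsOrbitRep σ = HasOrbitSize M σ × (∀ {τ} → τ ∈ orbit σ → ¬ T (lexLtᵇ τ σ))

  orbitRepᵇ⇒IsOrbitRep : ∀ σ → T (orbitRepᵇ M σ) → IsOrbitRep σ
  orbitRepᵇ⇒IsOrbitRep σ ok =
    let exact , least = Equivalence.to T-∧ ok
    in orbitSizeIsᵇ⇒HasOrbitSize M σ exact , λ τ∈orbit →
         let j , j∈upTo , τ≡σ^j = ∈-map⁻ (λ j → Kpow j σ) τ∈orbit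
         in subst (λ υ → ¬ T (lexLtᵇ υ σ)) (sym τ≡σ^j)
              (T-not⇒¬T (T-all-lookup (λ j → not (lexLtᵇ (Kpow j σ) σ)) (upTo M) least j∈upTo))

  IsOrbitRep⇒orbitRepᵇ : ∀ {σ} → IsOrbitRep σ → T (orbitRepᵇ M σ)
  IsOrbitRep⇒orbitRepᵇ {σ} (size , least) = Equivalence.from T-∧
    ( HasOrbitSize⇒orbitSizeIsᵇ size
    , T-all-tabulate (λ j → not (lexLtᵇ (Kpow j σ) σ)) (upTo M) (¬T⇒T-not ∘ least ∘ ∈-map⁺ (λ j → Kpow j σ)) )

  reps exact sweep : List (OneLine n)
  reps  = filterᵇ (orbitRepᵇ M) (Sn n)
  exact = filterᵇ (orbitSizeIsᵇ M) (Sn n)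
  sweep = cartesianProductWith (λ r j → Kpow j r) reps (upTo M)

  ∈-reps⁻ : ∀ {r} → r ∈ reps → IsPerm r × IsOrbitRep r
  ∈-reps⁻ {r} r∈reps = let r∈Sn , ok = ∈-filter⁻ (T? ∘ orbitRepᵇ M) {xs = Sn n} r∈reps
                       in ∈-Sn⁻ r∈Sn , orbitRepᵇ⇒IsOrbitRep r ok

  ∈-exact⁻ : ∀ {σ} → σ ∈ exact → IsPerm σ × HasOrbitSize M σ
  ∈-exact⁻ {σ} σ∈exact = let σ∈Sn , ok = ∈-filter⁻ (T? ∘ orbitSizeIsᵇ M) {xs = Sn n} σ∈exact
                         in ∈-Sn⁻ σ∈Sn , orbitSizeIsᵇ⇒HasOrbitSize M σ ok

  sweep⊆exact : sweep ⊆ exact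
  sweep⊆exact σ∈sweep =
    let r , j , r∈reps , _ , σ≡r^j = ∈-cartesianProductWith⁻ (λ r j → Kpow j r) reps (upTo M) σ∈sweep
        r-perm , r-size , _ = ∈-reps⁻ r∈reps
    in subst (_∈ exact) (sym σ≡r^j)
         (∈-filter⁺ (T? ∘ orbitSizeIsᵇ M) (∈-Sn⁺ (Kpow-isPerm j r-perm))
                    (HasOrbitSize⇒orbitSizeIsᵇ (HasOrbitSize-Kpow r-size j)))

  exact⊆sweep : exact ⊆ sweep
  exact⊆sweep {σ} σ∈exact =
    let σ-perm , σ-size = ∈-exact⁻ σ∈exact
        σ-periodic = HasOrbitSize.periodic σ-size
        r , r∈orbit-σ , r-least = lexLtᵇ-minimum (orbit σ) (∈-orbit σ-periodic 0)
        i , _ , r≡σ^i = ∈-map⁻ (λ j → Kpow j σ) r∈orbit-σ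
        r-size = subst (HasOrbitSize M) (sym r≡σ^i) (HasOrbitSize-Kpow σ-size i)
        r∈reps = ∈-filter⁺ (T? ∘ orbitRepᵇ M)
          (∈-Sn⁺ (subst IsPerm (sym r≡σ^i) (Kpow-isPerm i σ-perm)))
          (IsOrbitRep⇒orbitRepᵇ (r-size , r-least ∘ orbit-trans σ-periodic r∈orbit-σ))
        j , j∈upTo , σ≡r^j = ∈-map⁻ (λ j → Kpow j r) (orbit-sym σ-periodic r∈orbit-σ)
    in subst (_∈ sweep) (sym σ≡r^j) (∈-cartesianProductWith⁺ (λ r j → Kpow j r) r∈reps j∈upTo)

  orbitRep-unique : ∀ {r r′} → IsOrbitRep r → IsOrbitRep r′ → r ∈ orbit r′ → r ≡ r′
  orbitRep-unique {r} {r′} (_ , r-least) (r′-size , r′-least) r∈orbit-r′ with r ≟ r′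
  ... | yes r≡r′ = r≡r′
  ... | no  r≢r′ = contradiction (lexLtᵇ-total r r′ r≢r′)
    Sum.[ r′-least r∈orbit-r′ , r-least (orbit-sym (HasOrbitSize.periodic r′-size) r∈orbit-r′) ]′

  sweep-unique : Unique sweep
  sweep-unique = cartesianProductWith-unique (λ r j → Kpow j r)
    (filter⁺ (T? ∘ orbitRepᵇ M) (Sn-unique n)) (upTo⁺ M) same-rep
    where
    same-rep : ∀ {r r′ j j′} → r ∈ reps → r′ ∈ reps → j ∈ upTo M → j′ ∈ upTo M →
      Kpow j r ≡ Kpow j′ r′ → r ≡ r′ × j ≡ j′
    same-rep {r} {r′} {j} {j′} r∈reps r′∈reps j∈upTo j′∈upTo r^j≡r′^j′ =
      r≡r′ , Kpow-injective-below (proj₁ r-rep) (∈-upTo⁻ j∈upTo) (∈-upTo⁻ j′∈upTo)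
               (trans r^j≡r′^j′ (cong (Kpow j′) (sym r≡r′)))
      where
      r-rep  = proj₂ (∈-reps⁻ r∈reps)
      r′-rep = proj₂ (∈-reps⁻ r′∈reps)
      r-periodic  = HasOrbitSize.periodic (proj₁ r-rep)
      r′-periodic = HasOrbitSize.periodic (proj₁ r′-rep)
      r∈orbit-r′ : r ∈ orbit r′
      r∈orbit-r′ = orbit-trans r′-periodic (subst (_∈ orbit r′) (sym r^j≡r′^j′) (∈-orbit r′-periodic j′))
                                            (orbit-sym r-periodic (∈-orbit r-periodic j))
      r≡r′ : r ≡ r′
      r≡r′ = orbitRep-unique r-rep r′-rep r∈orbit-r′

  length-exact : length exact ≡ numOrbitsOfSize n M * M
  length-exact = begin
    length exact
      ≡⟨ unique-⊆-antisym⇒length-≡ (filter⁺ (T? ∘ orbitSizeIsᵇ M) (Sn-unique n)) sweep-unique exact⊆sweep sweep⊆exact ⟩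
    length sweep                  ≡⟨ length-cartesianProductWith (λ r j → Kpow j r) reps (upTo M) ⟩
    length reps * length (upTo M) ≡⟨ cong (length reps *_) (length-upTo M) ⟩
    length reps * M               ∎

orbit-decomposition : ∀ {n M} → 0 < M → numOrbitsOfSize n M * M + numInProperDivisorOrbits n M ≡ numFixedBy n M
orbit-decomposition {n} {M} 0<M = begin
  numOrbitsOfSize n M * M + numInProperDivisorOrbits n M
    ≡⟨ cong (_+ numInProperDivisorOrbits n M) (OrbitCount.length-exact {n} 0<M) ⟨
  length (filterᵇ (orbitSizeIsᵇ M) (Sn n)) + numInProperDivisorOrbits n M
    ≡⟨ numFixedBy-partition {n} 0<M ⟨
  numFixedBy n M
    ∎

theorem7p6 : (n k q : ℕ) → 0 < n → 2 * n ≡ (2 * k) * q →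
    (numFixedBy n (2 * k) ≡ (q ^ k) * (k !))
    × (numOrbitsOfSize n (2 * k) * (2 * k) + numInProperDivisorOrbits n (2 * k) ≡ (q ^ k) * (k !))
theorem7p6 (suc m) zero     q        _ ()
theorem7p6 (suc m) (suc k′) zero     _ 2n≡0   = contradiction (trans 2n≡0 (*-zeroʳ (2 * suc k′))) λ ()
theorem7p6 (suc m) (suc k′) (suc q′) _ 2n≡2kq = fixed-count , trans (orbit-decomposition {suc m} {2 * suc k′} z<s) fixed-count
  where
  n≡q*k : suc m ≡ suc q′ * suc k′
  n≡q*k = trans (*-cancelˡ-≡ (suc m) (suc k′ * suc q′) 2 (trans 2n≡2kq (*-assoc 2 (suc k′) (suc q′))))
                (*-comm (suc k′) (suc q′))
  fixed-count : numFixedBy (suc m) (2 * suc k′) ≡ suc q′ ^ suc k′ * suc k′ !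
  fixed-count = FixedPoints.numFixedBy-K^2k m k′ q′ n≡q*k
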